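{- Let $q$ be a complex number with $|q|<1$ and let $k,m$ be positive integers with $m\ge k$. Then, for each choice of sign (upper signs throughout, or lower signs throughout), \begin{align*} A_{k,m}^{\pm}(q)&=\frac{1}{(\pm q;q)_m^2}\sum_{i=0}^{m-k}\sum_{j=i+k}^m(\mp 1)^{j-i-k}\frac{j-i}{k}{j-i+k-1\choose 2k-1}{m\brack i}_q{m\brack j}_q q^{\frac{i(i+1)}{2}+\frac{j(j+1)}{2}},\\ C_{k,m}^{\pm}(q)&=\frac{1}{(\pm q;q^2)_m^2}\sum_{i=0}^{m-k}\sum_{j=i+k}^m(\mp 1)^{j-i-k}\frac{j-i}{k}{j-i+k-1\choose 2k-1}{m\brack i}_{q^2}{m\brack j}_{q^2} q^{i^2+j^2}. \end{align*}
   Context: The $q$-shifted factorial is $(a;q)_0=1$ and $(a;q)_n=(1-a)(1-aq)\cdots(1-aq^{n-1})$ for $n\ge1$. The $q$-binomial coefficient is ${n\brack k}_q=\frac{(q;q)_n}{(q;q)_k(q;q)_{n-k}}$ if $0\le k\le n$ and $0$ otherwise; ${n\brack k}_{q^2}$ is the same with $q$ replaced by $q^2$. The truncated MacMahon $q$-series are \[ A_{k,m}^{\pm}(q)=\sum_{1\le \lambda_1<\lambda_2<\cdots<\lambda_k\le m}\frac{q^{\lambda_1+\lambda_2+\cdots+\lambda_k}}{(1\mp q^{\lambda_1})^2 (1\mp q^{\lambda_2})^2\cdots (1\mp q^{\lambda_k})^2}, \] \[ C_{k,m}^{\pm}(q)=\sum_{1\le \lambda_1<\lambda_2<\cdots<\lambda_k\le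 m}\frac{q^{2\lambda_1+2\lambda_2+\cdots+2\lambda_k-k}}{(1\mp q^{2\lambda_1-1})^2 (1\mp q^{2\lambda_2-1})^2\cdots (1\mp q^{2\lambda_k-1})^2}, \] where the sums range over integers $\lambda_1,\dots,\lambda_k$. -}

module Defs where

open import Level using (Level; _⊔_) renaming (suc to lsuc)
open import Data.Nat as ℕ using (ℕ; zero; suc; _∸_)
open import Data.Nat.Combinatorics using () renaming (_C_ to binom)
open import Relation.Nullary using (¬_)
import Data.Bool
open import Algebra.Bundles using (CommutativeRing)

-- A field: a commutative ring with 0 ≠ 1 and a (total) inverse operation,
-- which is a genuine inverse on nonzero elements (value at 0 is irrelevant;
-- Mathlib-style convention).  ℂ is an instance.
record Field (c ℓ : Level) : Set (lsuc (c ⊔ ℓ)) where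
  field
    commutativeRing : CommutativeRing c ℓ
  open CommutativeRing commutativeRing public
  field
    _⁻¹       : Carrier → Carrier
    ⁻¹-cong   : ∀ {x y} → x ≈ y → (x ⁻¹) ≈ (y ⁻¹)
    ⁻¹-inverse : ∀ x → ¬ (x ≈ 0#) → (x * (x ⁻¹)) ≈ 1#
    0≉1       : ¬ (0# ≈ 1#)

data Sign : Set where
  upper lower : Sign

module FieldDefs {c ℓ : Level} (F : Field c ℓ) where
  open Field F

  _^_ : Carrier → ℕ → Carrier
  x ^ zero = 1#
  x ^ suc n = x * (x ^ n)

  fromℕ : ℕ → Carrier
  fromℕ zero = 0#
  fromℕ (suc n) = 1# + fromℕ n

  CharZero : Set ℓ
  CharZero = ∀ n → ¬ (fromℕ (suc n) ≈ 0#)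

  ⟦_⟧ : Sign → Carrier
  ⟦ upper ⟧ = 1#
  ⟦ lower ⟧ = - 1#

  sumFrom : ℕ → ℕ → (ℕ → Carrier) → Carrier
  sumFrom a zero f = 0#
  sumFrom a (suc n) f = f a + sumFrom (suc a) n f

  -- Σ_{x=a}^{b} f x   (empty, i.e. 0, when b < a)
  sumRange : ℕ → ℕ → (ℕ → Carrier) → Carrier
  sumRange a b f = sumFrom a (suc b ∸ a) f

  prod : ℕ → (ℕ → Carrier) → Carrier
  prod zero f = 1#
  prod (suc n) f = prod n f * f n

  qPoch : Carrier → Carrier → ℕ → Carrier
  qPoch a p n = prod n (λ t → 1# - (a * (p ^ t)))

  qBinom : Carrier → ℕ → ℕ → Carrier
  qBinom p n k with k ℕ.≤ᵇ n
  ... | Data.Bool.true  = qPoch p p n * ((qPoch p p k * qPoch p p (n ∸ k)) ⁻¹)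
  ... | Data.Bool.false = 0#

  -- Σ over lo ≤ λ₁ < λ₂ < ⋯ < λ_k ≤ m of Π_i f λᵢ
  incrSum : ℕ → ℕ → ℕ → (ℕ → Carrier) → Carrier
  incrSum zero lo m f = 1#
  incrSum (suc k) lo m f = sumRange lo m (λ l → f l * incrSum k (suc l) m f)

  sq : Carrier → Carrier
  sq x = x * x

  A : Sign → ℕ → ℕ → Carrier → Carrier
  A s k m q = incrSum k 1 m (λ l → (q ^ l) * (sq (1# - (⟦ s ⟧ * (q ^ l))) ⁻¹))

  -- truncated MacMahon series C^±_{k,m}(q); q^{2λ₁+⋯+2λ_k-k} = Π q^{2λᵢ-1}
  Cser : Sign → ℕ → ℕ → Carrier → Carrier
  Cser s k m q = incrSum k 1 m
    (λ l → (q ^ (2 ℕ.* l ∸ 1)) * (sq (1# - (⟦ s ⟧ * (q ^ (2 ℕ.* l ∸ 1)))) ⁻¹))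

  coeff : Sign → ℕ → ℕ → ℕ → Carrier
  coeff s k i j =
    (((- ⟦ s ⟧) ^ (j ∸ i ∸ k)) * (fromℕ (j ∸ i) * (fromℕ k ⁻¹)))
      * fromℕ (binom (j ∸ i ℕ.+ k ∸ 1) (2 ℕ.* k ∸ 1))

  rhsA : Sign → ℕ → ℕ → Carrier → Carrier
  rhsA s k m q =
    (sq (qPoch (⟦ s ⟧ * q) q m) ⁻¹) *
    sumRange 0 (m ∸ k) (λ i → sumRange (i ℕ.+ k) m (λ j →
      ((coeff s k i j * qBinom q m i) * qBinom q m j)
        * (q ^ ((i ℕ.* suc i) ℕ./ 2 ℕ.+ (j ℕ.* suc j) ℕ./ 2))))

  rhsC : Sign → ℕ → ℕ → Carrier → Carrier
  rhsC s k m q =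
    (sq (qPoch (⟦ s ⟧ * q) (q * q) m) ⁻¹) *
    sumRange 0 (m ∸ k) (λ i → sumRange (i ℕ.+ k) m (λ j →
      ((coeff s k i j * qBinom (q * q) m i) * qBinom (q * q) m j)
        * (q ^ (i ℕ.* i ℕ.+ j ℕ.* j))))

-- Put α t = r pᵗ, σ = ±1 and τ = −σ.  A and C are elementary symmetric functions of the
-- weights α t / (1 − σ α t)² (r = p = q, respectively r = q and p = q²), i.e. coefficients of
-- ∏_{t<m} ((1 − σ α t)² + α t x) / ∏_{t<m} (1 − σ α t)².  Writing x + 2τ = y + y⁻¹ factors the
-- numerator as P(y) P(y⁻¹) with P(y) = ∏_{t<m} (1 + α t y), whose coefficients are given by Rothe's
-- q-binomial theorem.  Collecting the powers y^{±d} and expanding yᵈ + y⁻ᵈ as a polynomial in x,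
-- whose coefficient of xᵏ is τ^{d−k} (d/k) C(d+k−1, 2k−1), yields the double sum with d = j − i.

module Submission where

open import Defs
open import Level using (Level)
open import Data.Nat as ℕ using (ℕ; zero; suc; _∸_; _≤_; _<_; s≤s; z≤n)
import Data.Nat.Properties as ℕₚ
open import Data.Bool as Bool using (true; false)
import Data.Nat.DivMod as DivMod
import Data.Nat.Divisibility as Divisibility
open import Data.Nat.Combinatorics using (_C_; nCk+nC[k+1]≡[n+1]C[k+1]; nC1≡n)
open import Data.Nat.Combinatorics.Specification using (k>n⇒nCk≡0)
open import Data.Nat.Solver using (module +-*-Solver)
open import Data.Integer as ℤ using (ℤ; -[1+_]; _⊖_; _◃_; sign; ∣_∣)
import Data.Integer.Properties as ℤₚ
import Data.Sign as Sign
open import Data.Maybe using (Maybe; just; nothing)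
open import Data.Product using (_×_; _,_; proj₁; proj₂)
open import Relation.Nullary using (¬_; Dec; yes; no)
open import Relation.Binary.PropositionalEquality as ≡ using (_≡_)
open import Algebra.Bundles using (CommutativeRing)
import Algebra.Solver.Ring as RingSolver
import Algebra.Solver.Ring.AlmostCommutativeRing as ACR
import Algebra.Properties.Ring as RingProperties
import Algebra.Properties.Semiring.Mult.TCOptimised as SemiringMult
import Algebra.Properties.CommutativeSemigroup as CommutativeSemigroupProperties

triangular-suc : ∀ i → suc i ℕ.* suc (suc i) ℕ./ 2 ≡ i ℕ.* suc i ℕ./ 2 ℕ.+ suc i
triangular-suc i = ≡.trans (≡.cong (ℕ._/ 2) (solve 1 (λ i → (con 1 :+ i) :* (con 2 :+ i) := i :* (con 1 :+ i) :+ (con 1 :+ i) :* con 2) ≡.refl i))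
                   (≡.trans (DivMod.+-distrib-/-∣ʳ (i ℕ.* suc i) (Divisibility.divides-refl (suc i)))
                            (≡.cong (i ℕ.* suc i ℕ./ 2 ℕ.+_) (DivMod.m*n/n≡m (suc i) 2)))
  where open +-*-Solver using (solve; _:=_; _:+_; _:*_; con)

square-suc : ∀ i → i ℕ.* i ℕ.+ suc (i ℕ.+ i) ≡ suc i ℕ.* suc i
square-suc = solve 1 (λ i → i :* i :+ (con 1 :+ (i :+ i)) := (con 1 :+ i) :* (con 1 :+ i)) ≡.refl
  where open +-*-Solver using (solve; _:=_; _:+_; _:*_; con)

module Lucas where
  open import Data.Nat using (_+_; _*_)
  open ≡ using (refl; cong; cong₂; sym)
  open +-*-Solver using (solve; _:=_; _:+_; _:*_; con)
  open ≡.≡-Reasoning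

  [n+1]C[k+1]≡nCk+nC[k+1] : ∀ n k → suc n C suc k ≡ n C k + n C suc k
  [n+1]C[k+1]≡nCk+nC[k+1] n k = sym (nCk+nC[k+1]≡[n+1]C[k+1] n k)

  [k+1]*[n+1]C[k+1]≡[n+1]*nCk : ∀ n k → suc k * (suc n C suc k) ≡ suc n * (n C k)
  [k+1]*[n+1]C[k+1]≡[n+1]*nCk zero zero = refl
  [k+1]*[n+1]C[k+1]≡[n+1]*nCk zero (suc k) = ℕₚ.*-zeroʳ (suc (suc k))
  [k+1]*[n+1]C[k+1]≡[n+1]*nCk (suc n) zero = begin
    1 * (suc (suc n) C 1) ≡⟨ cong (1 *_) (nC1≡n (suc (suc n))) ⟩
    1 * suc (suc n)       ≡⟨ ℕₚ.*-comm 1 (suc (suc n)) ⟩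
    suc (suc n) * 1       ∎
  [k+1]*[n+1]C[k+1]≡[n+1]*nCk (suc n) (suc k) = begin
    suc (suc k) * (suc (suc n) C suc (suc k))
      ≡⟨ cong (suc (suc k) *_) ([n+1]C[k+1]≡nCk+nC[k+1] (suc n) (suc k)) ⟩
    suc (suc k) * (x + y)
      ≡⟨ solve 3 (λ k x y → (con 2 :+ k) :* (x :+ y) := ((con 1 :+ k) :* x :+ x) :+ (con 2 :+ k) :* y) refl k x y ⟩
    (suc k * x + x) + suc (suc k) * y
      ≡⟨ cong₂ (λ a b → (a + x) + b) ([k+1]*[n+1]C[k+1]≡[n+1]*nCk n k) ([k+1]*[n+1]C[k+1]≡[n+1]*nCk n (suc k)) ⟩
    (suc n * (n C k) + x) + suc n * (n C suc k)
      ≡⟨ cong (λ z → (suc n * (n C k) + z) + suc n * (n C suc k)) ([n+1]C[k+1]≡nCk+nC[k+1] n k) ⟩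
    (suc n * (n C k) + (n C k + n C suc k)) + suc n * (n C suc k)
      ≡⟨ solve 3 (λ n a b → (((con 1 :+ n) :* a) :+ (a :+ b)) :+ (con 1 :+ n) :* b := (con 2 :+ n) :* (a :+ b)) refl n (n C k) (n C suc k) ⟩
    suc (suc n) * (n C k + n C suc k)
      ≡⟨ cong (suc (suc n) *_) ([n+1]C[k+1]≡nCk+nC[k+1] n k) ⟨
    suc (suc n) * (suc n C suc k) ∎
    where
    x = suc n C suc k
    y = suc n C suc (suc k)

  -- zᵈ + z⁻ᵈ = Σₖ lucas d k (z + z⁻¹ − 2)ᵏ.
  lucas : ℕ → ℕ → ℕ
  lucas d zero = 2
  lucas d (suc k) = suc (d + k) C suc (suc (k + k)) + (d + k) C suc (suc (k + k))

  lucas-vanishes : ∀ {d k} → d < k → lucas d k ≡ 0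
  lucas-vanishes {d} {suc k} (s≤s d≤k) = cong₂ _+_
    (k>n⇒nCk≡0 (s≤s (s≤s (ℕₚ.+-monoˡ-≤ k d≤k))))
    (k>n⇒nCk≡0 (ℕₚ.m<n⇒m<1+n (s≤s (ℕₚ.+-monoˡ-≤ k d≤k))))

  lucas-suc : ∀ d k → lucas (suc d) k ≡ suc (d + k) C (k + k) + (d + k) C (k + k)
  lucas-suc d zero = refl
  lucas-suc d (suc k) = cong₂ (λ n j → suc n C j + n C j) (sym (ℕₚ.+-suc d k)) (cong suc (sym (ℕₚ.+-suc k k)))

  -- (z + z⁻¹) (zᵈ⁺¹ + z⁻ᵈ⁻¹) = (zᵈ⁺² + z⁻ᵈ⁻²) + (zᵈ + z⁻ᵈ), read off at (z + z⁻¹ − 2)ᵏ⁺¹.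
  lucas-recurrence : ∀ d k → lucas (2 + d) (suc k) + lucas d (suc k) ≡ 2 * lucas (1 + d) (suc k) + lucas (1 + d) k
  lucas-recurrence d k = ≡.trans (pascal-identity (d + k) (k + k)) (cong (λ z → 2 * lucas (1 + d) (suc k) + z) (sym (lucas-suc d k)))
    where
    pascal-identity : ∀ n j →
      ((3 + n) C (2 + j) + (2 + n) C (2 + j)) + ((1 + n) C (2 + j) + n C (2 + j))
        ≡ 2 * ((2 + n) C (2 + j) + (1 + n) C (2 + j)) + ((1 + n) C j + n C j)
    pascal-identity n j
      rewrite [n+1]C[k+1]≡nCk+nC[k+1] (2 + n) (1 + j) | [n+1]C[k+1]≡nCk+nC[k+1] (1 + n) j
            | [n+1]C[k+1]≡nCk+nC[k+1] (1 + n) (1 + j) | [n+1]C[k+1]≡nCk+nC[k+1] n j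
            | [n+1]C[k+1]≡nCk+nC[k+1] n (1 + j)
      = solve 4 (λ a b c e → (((e :+ (a :+ b)) :+ ((a :+ b) :+ (b :+ c))) :+ ((a :+ b) :+ (b :+ c))) :+ ((b :+ c) :+ c)
                            := con 2 :* (((a :+ b) :+ (b :+ c)) :+ (b :+ c)) :+ (e :+ a))
                refl (n C j) (n C suc j) (n C suc (suc j)) (suc n C j)

  lucas-closed : ∀ d k → suc k * lucas (suc d) (suc k) ≡ suc d * (suc (d + k) C suc (k + k))
  lucas-closed d k = ℕₚ.*-cancelˡ-≡ _ _ 2 (ℕₚ.+-cancelʳ-≡ _ _ _ (begin
      2 * (suc k * lucas (suc d) (suc k)) + suc j * B
        ≡⟨ cong (λ z → 2 * (suc k * (z + Y)) + suc j * B) ([n+1]C[k+1]≡nCk+nC[k+1] n j) ⟩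
      2 * (suc k * ((B + Y) + Y)) + suc j * B
        ≡⟨ solve 3 (λ k B Y → con 2 :* ((con 1 :+ k) :* ((B :+ Y) :+ Y)) :+ (con 2 :+ (k :+ k)) :* B := con 2 :* ((con 2 :+ (k :+ k)) :* (B :+ Y))) refl k B Y ⟩
      2 * (suc j * (B + Y))
        ≡⟨ cong (λ z → 2 * (suc j * z)) ([n+1]C[k+1]≡nCk+nC[k+1] n j) ⟨
      2 * (suc j * (suc n C suc j))
        ≡⟨ cong (2 *_) ([k+1]*[n+1]C[k+1]≡[n+1]*nCk n j) ⟩
      2 * (suc n * B)
        ≡⟨ solve 3 (λ d k B → con 2 :* ((con 2 :+ (d :+ k)) :* B) := con 2 :* ((con 1 :+ d) :* B) :+ (con 2 :+ (k :+ k)) :* B) refl d k B ⟩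
      2 * (suc d * B) + suc j * B ∎))
    where
    n = suc (d + k)
    j = suc (k + k)
    B = n C j
    Y = n C suc j

module IntegerCoefficientSolver {c ℓ : Level} (R : CommutativeRing c ℓ) where
  open CommutativeRing R
  open RingProperties ring using (-‿distribʳ-*; -‿involutive; -0#≈0#; -‿+-comm; -1*x≈-x)
  open SemiringMult semiring using (×-homo-+; ×1-homo-*) renaming (_×_ to _×′_)
  open CommutativeSemigroupProperties *-commutativeSemigroup using () renaming (interchange to *-interchange)
  open CommutativeSemigroupProperties +-commutativeSemigroup using () renaming (interchange to +-interchange)
  open import Relation.Binary.Reasoning.Setoid setoid

  signed : Sign.Sign → Carrier
  signed Sign.+ = 1#
  signed Sign.- = - 1#

  -- The optimised multiple has 1 ×′ x = x definitionally; the solver needs this, since it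
  -- closes goals by checking that both normal forms evaluate to the same term.
  ⟦_⟧ℤ : ℤ → Carrier
  ⟦ ℤ.+ n ⟧ℤ = n ×′ 1#
  ⟦ -[1+ n ] ⟧ℤ = - (suc n ×′ 1#)

  signed-homo : ∀ s t → signed (s Sign.* t) ≈ signed s * signed t
  signed-homo Sign.+ t = sym (*-identityˡ _)
  signed-homo Sign.- Sign.+ = sym (*-identityʳ _)
  signed-homo Sign.- Sign.- = begin
    1#            ≈⟨ -‿involutive 1# ⟨
    - - 1#        ≈⟨ -‿cong (-1*x≈-x 1#) ⟨
    - (- 1# * 1#) ≈⟨ -‿distribʳ-* (- 1#) 1# ⟩
    - 1# * - 1#   ∎

  ⟦◃⟧ : ∀ s n → ⟦ s ◃ n ⟧ℤ ≈ signed s * (n ×′ 1#)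
  ⟦◃⟧ s zero = sym (zeroʳ _)
  ⟦◃⟧ Sign.+ (suc n) = sym (*-identityˡ _)
  ⟦◃⟧ Sign.- (suc n) = sym (-1*x≈-x _)

  ⟦⟧ℤ-by-sign : ∀ i → ⟦ i ⟧ℤ ≈ signed (sign i) * (∣ i ∣ ×′ 1#)
  ⟦⟧ℤ-by-sign i = trans (reflexive (≡.cong ⟦_⟧ℤ (≡.sym (ℤₚ.◃-inverse i)))) (⟦◃⟧ (sign i) ∣ i ∣)

  ⟦⟧ℤ-homo-* : ∀ i j → ⟦ i ℤ.* j ⟧ℤ ≈ ⟦ i ⟧ℤ * ⟦ j ⟧ℤ
  ⟦⟧ℤ-homo-* i j = begin
    ⟦ i ℤ.* j ⟧ℤ                                                      ≈⟨ ⟦◃⟧ (sign i Sign.* sign j) (∣ i ∣ ℕ.* ∣ j ∣) ⟩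
    signed (sign i Sign.* sign j) * ((∣ i ∣ ℕ.* ∣ j ∣) ×′ 1#)         ≈⟨ *-cong (signed-homo (sign i) (sign j)) (×1-homo-* ∣ i ∣ ∣ j ∣) ⟩
    (signed (sign i) * signed (sign j)) * (∣ i ∣ ×′ 1# * ∣ j ∣ ×′ 1#) ≈⟨ *-interchange _ _ _ _ ⟩
    (signed (sign i) * ∣ i ∣ ×′ 1#) * (signed (sign j) * ∣ j ∣ ×′ 1#) ≈⟨ *-cong (⟦⟧ℤ-by-sign i) (⟦⟧ℤ-by-sign j) ⟨
    ⟦ i ⟧ℤ * ⟦ j ⟧ℤ                                                   ∎

  ⟦⊖⟧ : ∀ m n → ⟦ m ⊖ n ⟧ℤ ≈ m ×′ 1# - n ×′ 1#
  ⟦⊖⟧ m zero = sym (trans (+-congˡ -0#≈0#) (+-identityʳ _))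
  ⟦⊖⟧ zero (suc n) = sym (+-identityˡ _)
  ⟦⊖⟧ (suc m) (suc n) = begin
    ⟦ suc m ⊖ suc n ⟧ℤ                    ≡⟨ ≡.cong ⟦_⟧ℤ (ℤₚ.[1+m]⊖[1+n]≡m⊖n m n) ⟩
    ⟦ m ⊖ n ⟧ℤ                            ≈⟨ ⟦⊖⟧ m n ⟩
    m ×′ 1# - n ×′ 1#                     ≈⟨ +-identityˡ _ ⟨
    0# + (m ×′ 1# - n ×′ 1#)              ≈⟨ +-congʳ (-‿inverseʳ 1#) ⟨
    (1# - 1#) + (m ×′ 1# - n ×′ 1#)       ≈⟨ +-interchange _ _ _ _ ⟩
    (1# + m ×′ 1#) + (- 1# + - (n ×′ 1#)) ≈⟨ +-congˡ (-‿+-comm 1# (n ×′ 1#)) ⟩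
    (1# + m ×′ 1#) - (1# + n ×′ 1#)       ≈⟨ +-cong (×-homo-+ 1# 1 m) (-‿cong (×-homo-+ 1# 1 n)) ⟨
    suc m ×′ 1# - suc n ×′ 1#             ∎

  ⟦⟧ℤ-homo-+ : ∀ i j → ⟦ i ℤ.+ j ⟧ℤ ≈ ⟦ i ⟧ℤ + ⟦ j ⟧ℤ
  ⟦⟧ℤ-homo-+ (ℤ.+ m) (ℤ.+ n) = ×-homo-+ 1# m n
  ⟦⟧ℤ-homo-+ (ℤ.+ m) -[1+ n ] = ⟦⊖⟧ m (suc n)
  ⟦⟧ℤ-homo-+ -[1+ m ] (ℤ.+ n) = trans (⟦⊖⟧ n (suc m)) (+-comm _ _)
  ⟦⟧ℤ-homo-+ -[1+ m ] -[1+ n ] = begin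
    - (suc (suc (m ℕ.+ n)) ×′ 1#)     ≡⟨ ≡.cong (λ k → - (suc k ×′ 1#)) (ℕₚ.+-suc m n) ⟨
    - ((suc m ℕ.+ suc n) ×′ 1#)       ≈⟨ -‿cong (×-homo-+ 1# (suc m) (suc n)) ⟩
    - (suc m ×′ 1# + suc n ×′ 1#)     ≈⟨ -‿+-comm _ _ ⟨
    - (suc m ×′ 1#) + - (suc n ×′ 1#) ∎

  ⟦⟧ℤ-homo-- : ∀ i → ⟦ ℤ.- i ⟧ℤ ≈ - ⟦ i ⟧ℤ
  ⟦⟧ℤ-homo-- (ℤ.+ zero) = sym -0#≈0#
  ⟦⟧ℤ-homo-- (ℤ.+ suc n) = refl
  ⟦⟧ℤ-homo-- -[1+ n ] = sym (-‿involutive _)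

  private
    ACRing = ACR.fromCommutativeRing R

    ⟦⟧ℤ-morphism : ACR._-Raw-AlmostCommutative⟶_ ℤ.+-*-rawRing ACRing
    ⟦⟧ℤ-morphism = record
      { ⟦_⟧ = ⟦_⟧ℤ ; +-homo = ⟦⟧ℤ-homo-+ ; *-homo = ⟦⟧ℤ-homo-*
      ; -‿homo = ⟦⟧ℤ-homo-- ; 0-homo = refl ; 1-homo = refl }

    ⟦⟧ℤ-≟ : ∀ i j → Maybe (⟦ i ⟧ℤ ≈ ⟦ j ⟧ℤ)
    ⟦⟧ℤ-≟ i j with i ℤ.≟ j
    ... | yes ≡.refl = just refl
    ... | no _ = nothing

  open RingSolver ℤ.+-*-rawRing ACRing ⟦⟧ℤ-morphism ⟦⟧ℤ-≟ public using (solve; _:=_; _:+_; _:*_; _:-_; :-_; con)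


module Expansion {c ℓ : Level} (F : Field c ℓ) where
  open Field F hiding (zero)
  open FieldDefs F
  open IntegerCoefficientSolver commutativeRing using (solve; _:=_; _:+_; _:*_; _:-_; :-_; con)
  open RingProperties ring using (-‿distribˡ-*; -‿distribʳ-*; -‿involutive; -0#≈0#; -1*x≈-x)
  open import Algebra.Properties.Semiring.Mult semiring using (×-homo-+; ×1-homo-*) renaming (_×_ to _×ᵤ_)
  import Algebra.Properties.CommutativeSemiring.Exp commutativeSemiring as Exp
  open import Algebra.Properties.Group +-group using (x∙y⁻¹≈ε⇒x≈y)
  open CommutativeSemigroupProperties +-commutativeSemigroup using () renaming (interchange to +-interchange)
  open import Relation.Binary.Reasoning.Setoid setoid

  fromℕ≡×1# : ∀ n → fromℕ n ≡ n ×ᵤ 1#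
  fromℕ≡×1# zero = ≡.refl
  fromℕ≡×1# (suc n) = ≡.cong (1# +_) (fromℕ≡×1# n)

  fromℕ-homo-+ : ∀ m n → fromℕ (m ℕ.+ n) ≈ fromℕ m + fromℕ n
  fromℕ-homo-+ m n rewrite fromℕ≡×1# (m ℕ.+ n) | fromℕ≡×1# m | fromℕ≡×1# n = ×-homo-+ 1# m n

  fromℕ-homo-* : ∀ m n → fromℕ (m ℕ.* n) ≈ fromℕ m * fromℕ n
  fromℕ-homo-* m n rewrite fromℕ≡×1# (m ℕ.* n) | fromℕ≡×1# m | fromℕ≡×1# n = ×1-homo-* m n

  ^≡^ : ∀ x n → x ^ n ≡ x Exp.^ n
  ^≡^ x zero = ≡.refl
  ^≡^ x (suc n) = ≡.cong (x *_) (^≡^ x n)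

  ^-homo-* : ∀ x m n → x ^ (m ℕ.+ n) ≈ x ^ m * x ^ n
  ^-homo-* x m n rewrite ^≡^ x (m ℕ.+ n) | ^≡^ x m | ^≡^ x n = Exp.^-homo-* x m n

  ^-congʳ : ∀ x {m n} → m ≡ n → x ^ m ≈ x ^ n
  ^-congʳ x m≡n = reflexive (≡.cong (x ^_) m≡n)

  [x*x]^n≈x^[n+n] : ∀ x n → (x * x) ^ n ≈ x ^ (n ℕ.+ n)
  [x*x]^n≈x^[n+n] x n rewrite ^≡^ (x * x) n | ^≡^ x (n ℕ.+ n) =
    trans (Exp.^-distrib-* x x n) (sym (Exp.^-homo-* x n n))

  ^-involution : ∀ {τ} → τ * τ ≈ 1# → ∀ n → τ ^ (2 ℕ.+ n) ≈ τ ^ n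
  ^-involution ττ≈1 n = trans (sym (*-assoc _ _ _)) (trans (*-congʳ ττ≈1) (*-identityˡ _))

  x*y≉0 : ∀ {x y} → ¬ (x ≈ 0#) → ¬ (y ≈ 0#) → ¬ (x * y ≈ 0#)
  x*y≉0 {x} {y} x≉0 y≉0 xy≈0 = y≉0 (begin
    y              ≈⟨ *-identityˡ y ⟨
    1# * y         ≈⟨ *-congʳ (trans (*-comm _ _) (⁻¹-inverse x x≉0)) ⟨
    (x ⁻¹ * x) * y ≈⟨ *-assoc _ _ _ ⟩
    x ⁻¹ * (x * y) ≈⟨ *-congˡ xy≈0 ⟩
    x ⁻¹ * 0#      ≈⟨ zeroʳ _ ⟩
    0#             ∎)

  prod≉0 : ∀ n f → (∀ t → ¬ (f t ≈ 0#)) → ¬ (prod n f ≈ 0#)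
  prod≉0 zero f f≉0 1≈0 = 0≉1 (sym 1≈0)
  prod≉0 (suc n) f f≉0 = x*y≉0 (prod≉0 n f f≉0) (f≉0 n)

  x*y≈z⇒x≈z*y⁻¹ : ∀ {x y z} → ¬ (y ≈ 0#) → x * y ≈ z → x ≈ z * y ⁻¹
  x*y≈z⇒x≈z*y⁻¹ {x} {y} {z} y≉0 xy≈z = begin
    x              ≈⟨ *-identityʳ x ⟨
    x * 1#         ≈⟨ *-congˡ (⁻¹-inverse y y≉0) ⟨
    x * (y * y ⁻¹) ≈⟨ *-assoc _ _ _ ⟨
    (x * y) * y ⁻¹ ≈⟨ *-congʳ xy≈z ⟩
    z * y ⁻¹       ∎

  x*y⁻¹*y≈x : ∀ x {y} → ¬ (y ≈ 0#) → (x * y ⁻¹) * y ≈ x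
  x*y⁻¹*y≈x x {y} y≉0 = trans (*-assoc _ _ _) (trans (*-congˡ (trans (*-comm _ _) (⁻¹-inverse y y≉0))) (*-identityʳ x))

  1-x≈0⇒x≈1 : ∀ {x} → 1# - x ≈ 0# → x ≈ 1#
  1-x≈0⇒x≈1 1-x≈0 = sym (x∙y⁻¹≈ε⇒x≈y _ _ 1-x≈0)

  Σ : ℕ → (ℕ → Carrier) → Carrier
  Σ n f = sumFrom 0 n f

  sumFrom-suc : ∀ a n f → sumFrom (suc a) n f ≡ sumFrom a n (λ x → f (suc x))
  sumFrom-suc a zero f = ≡.refl
  sumFrom-suc a (suc n) f = ≡.cong (f (suc a) +_) (sumFrom-suc (suc a) n f)

  sumFrom≡Σ : ∀ a n f → sumFrom a n f ≡ Σ n (λ t → f (a ℕ.+ t))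
  sumFrom≡Σ zero n f = ≡.refl
  sumFrom≡Σ (suc a) n f = ≡.trans (sumFrom-suc a n f) (sumFrom≡Σ a n (λ x → f (suc x)))

  Σ-suc : ∀ n f → Σ (suc n) f ≡ f 0 + Σ n (λ i → f (suc i))
  Σ-suc n f = ≡.cong (f 0 +_) (sumFrom-suc 0 n f)

  Σ-cong-< : ∀ n {f g} → (∀ i → i < n → f i ≈ g i) → Σ n f ≈ Σ n g
  Σ-cong-< zero f≈g = refl
  Σ-cong-< (suc n) {f} {g} f≈g = begin
    Σ (suc n) f                 ≡⟨ Σ-suc n f ⟩
    f 0 + Σ n (λ i → f (suc i)) ≈⟨ +-cong (f≈g 0 (s≤s z≤n)) (Σ-cong-< n (λ i i<n → f≈g (suc i) (s≤s i<n))) ⟩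
    g 0 + Σ n (λ i → g (suc i)) ≡⟨ Σ-suc n g ⟨
    Σ (suc n) g                 ∎

  Σ-cong : ∀ n {f g} → (∀ i → f i ≈ g i) → Σ n f ≈ Σ n g
  Σ-cong n f≈g = Σ-cong-< n (λ i _ → f≈g i)

  Σ-distrib-+ : ∀ n f g → Σ n (λ i → f i + g i) ≈ Σ n f + Σ n g
  Σ-distrib-+ zero f g = sym (+-identityʳ _)
  Σ-distrib-+ (suc n) f g = begin
    Σ (suc n) (λ i → f i + g i)                                   ≡⟨ Σ-suc n _ ⟩
    (f 0 + g 0) + Σ n (λ i → f (suc i) + g (suc i))               ≈⟨ +-congˡ (Σ-distrib-+ n _ _) ⟩
    (f 0 + g 0) + (Σ n (λ i → f (suc i)) + Σ n (λ i → g (suc i))) ≈⟨ +-interchange _ _ _ _ ⟩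
    (f 0 + Σ n (λ i → f (suc i))) + (g 0 + Σ n (λ i → g (suc i))) ≡⟨ ≡.cong₂ _+_ (Σ-suc n f) (Σ-suc n g) ⟨
    Σ (suc n) f + Σ (suc n) g                                     ∎

  Σ-distribˡ-* : ∀ n x f → Σ n (λ i → x * f i) ≈ x * Σ n f
  Σ-distribˡ-* zero x f = sym (zeroʳ _)
  Σ-distribˡ-* (suc n) x f = begin
    Σ (suc n) (λ i → x * f i)           ≡⟨ Σ-suc n _ ⟩
    x * f 0 + Σ n (λ i → x * f (suc i)) ≈⟨ +-congˡ (Σ-distribˡ-* n x _) ⟩
    x * f 0 + x * Σ n (λ i → f (suc i)) ≈⟨ distribˡ _ _ _ ⟨
    x * (f 0 + Σ n (λ i → f (suc i)))   ≡⟨ ≡.cong (x *_) (Σ-suc n f) ⟨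
    x * Σ (suc n) f                     ∎

  Σ-distribʳ-* : ∀ n x f → Σ n (λ i → f i * x) ≈ Σ n f * x
  Σ-distribʳ-* n x f = trans (Σ-cong n (λ i → *-comm _ _)) (trans (Σ-distribˡ-* n x f) (*-comm _ _))

  Σ-zero : ∀ n {f} → (∀ i → i < n → f i ≈ 0#) → Σ n f ≈ 0#
  Σ-zero zero f≈0 = refl
  Σ-zero (suc n) {f} f≈0 = begin
    Σ (suc n) f                 ≡⟨ Σ-suc n f ⟩
    f 0 + Σ n (λ i → f (suc i)) ≈⟨ +-cong (f≈0 0 (s≤s z≤n)) (Σ-zero n (λ i i<n → f≈0 (suc i) (s≤s i<n))) ⟩
    0# + 0#                     ≈⟨ +-identityˡ 0# ⟩
    0#                          ∎

  Σ-++ : ∀ n e f → Σ (n ℕ.+ e) f ≈ Σ n f + Σ e (λ i → f (n ℕ.+ i))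
  Σ-++ zero e f = sym (+-identityˡ _)
  Σ-++ (suc n) e f = begin
    Σ (suc n ℕ.+ e) f                                             ≡⟨ Σ-suc (n ℕ.+ e) f ⟩
    f 0 + Σ (n ℕ.+ e) (λ i → f (suc i))                           ≈⟨ +-congˡ (Σ-++ n e _) ⟩
    f 0 + (Σ n (λ i → f (suc i)) + Σ e (λ i → f (suc (n ℕ.+ i)))) ≈⟨ +-assoc _ _ _ ⟨
    (f 0 + Σ n (λ i → f (suc i))) + Σ e (λ i → f (suc n ℕ.+ i))   ≡⟨ ≡.cong (_+ Σ e (λ i → f (suc n ℕ.+ i))) (Σ-suc n f) ⟨
    Σ (suc n) f + Σ e (λ i → f (suc n ℕ.+ i))                     ∎

  Σ-snoc : ∀ n f → Σ (suc n) f ≈ Σ n f + f n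
  Σ-snoc n f = begin
    Σ (suc n) f                ≡⟨ ≡.cong (λ m → Σ m f) (ℕₚ.+-comm 1 n) ⟩
    Σ (n ℕ.+ 1) f              ≈⟨ Σ-++ n 1 f ⟩
    Σ n f + (f (n ℕ.+ 0) + 0#) ≈⟨ +-congˡ (trans (+-identityʳ _) (reflexive (≡.cong f (ℕₚ.+-identityʳ n)))) ⟩
    Σ n f + f n                ∎

  Σ-truncate : ∀ n N f → n ≤ N → (∀ i → n ≤ i → f i ≈ 0#) → Σ N f ≈ Σ n f
  Σ-truncate n N f n≤N f≈0 = begin
    Σ N f                                 ≡⟨ ≡.cong (λ m → Σ m f) (ℕₚ.m+[n∸m]≡n n≤N) ⟨
    Σ (n ℕ.+ (N ∸ n)) f                   ≈⟨ Σ-++ n (N ∸ n) f ⟩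
    Σ n f + Σ (N ∸ n) (λ i → f (n ℕ.+ i)) ≈⟨ +-congˡ (Σ-zero (N ∸ n) (λ i _ → f≈0 (n ℕ.+ i) (ℕₚ.m≤m+n n i))) ⟩
    Σ n f + 0#                            ≈⟨ +-identityʳ _ ⟩
    Σ n f                                 ∎

  Σ-comm : ∀ n e (h : ℕ → ℕ → Carrier) → Σ n (λ i → Σ e (h i)) ≈ Σ e (λ j → Σ n (λ i → h i j))
  Σ-comm zero e h = sym (Σ-zero e (λ _ _ → refl))
  Σ-comm (suc n) e h = begin
    Σ (suc n) (λ i → Σ e (h i))                     ≡⟨ Σ-suc n (λ i → Σ e (h i)) ⟩
    Σ e (h 0) + Σ n (λ i → Σ e (h (suc i)))         ≈⟨ +-congˡ (Σ-comm n e (λ i → h (suc i))) ⟩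
    Σ e (h 0) + Σ e (λ j → Σ n (λ i → h (suc i) j)) ≈⟨ Σ-distrib-+ e (h 0) (λ j → Σ n (λ i → h (suc i) j)) ⟨
    Σ e (λ j → h 0 j + Σ n (λ i → h (suc i) j))     ≈⟨ Σ-cong e (λ j → reflexive (≡.sym (Σ-suc n (λ i → h i j)))) ⟩
    Σ e (λ j → Σ (suc n) (λ i → h i j))             ∎

  prod-cong : ∀ n {f g} → (∀ t → f t ≈ g t) → prod n f ≈ prod n g
  prod-cong zero f≈g = refl
  prod-cong (suc n) f≈g = *-cong (prod-cong n f≈g) (f≈g n)

  prod-sq : ∀ n f → prod n (λ t → sq (f t)) ≈ sq (prod n f)
  prod-sq zero f = sym (*-identityˡ 1#)
  prod-sq (suc n) f = trans (*-congʳ (prod-sq n f)) (solve 2 (λ P x → (P :* P) :* (x :* x) := (P :* x) :* (P :* x)) refl (prod n f) (f n))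

  sumRange-cong : ∀ lo m {f g} → (∀ l → lo ≤ l → l ≤ m → f l ≈ g l) → sumRange lo m f ≈ sumRange lo m g
  sumRange-cong lo m {f} {g} f≈g = begin
    sumRange lo m f                     ≡⟨ sumFrom≡Σ lo (suc m ∸ lo) f ⟩
    Σ (suc m ∸ lo) (λ t → f (lo ℕ.+ t)) ≈⟨ Σ-cong-< (suc m ∸ lo) (λ t t< → f≈g (lo ℕ.+ t) (ℕₚ.m≤m+n lo t) (ℕₚ.≤-pred (<∸⇒+< lo t<))) ⟩
    Σ (suc m ∸ lo) (λ t → g (lo ℕ.+ t)) ≡⟨ sumFrom≡Σ lo (suc m ∸ lo) g ⟨
    sumRange lo m g                     ∎
    where
    <∸⇒+< : ∀ lo {t n} → t < n ∸ lo → lo ℕ.+ t < n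
    <∸⇒+< zero t<n = t<n
    <∸⇒+< (suc lo) {n = suc n} t<n∸lo = s≤s (<∸⇒+< lo t<n∸lo)

  sumRange-distrib-+ : ∀ lo m f g → sumRange lo m (λ l → f l + g l) ≈ sumRange lo m f + sumRange lo m g
  sumRange-distrib-+ lo m f g = begin
    sumRange lo m (λ l → f l + g l)                     ≡⟨ sumFrom≡Σ lo n (λ l → f l + g l) ⟩
    Σ n (λ t → f (lo ℕ.+ t) + g (lo ℕ.+ t))             ≈⟨ Σ-distrib-+ n (λ t → f (lo ℕ.+ t)) (λ t → g (lo ℕ.+ t)) ⟩
    Σ n (λ t → f (lo ℕ.+ t)) + Σ n (λ t → g (lo ℕ.+ t)) ≡⟨ ≡.cong₂ _+_ (sumFrom≡Σ lo n f) (sumFrom≡Σ lo n g) ⟨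
    sumRange lo m f + sumRange lo m g                   ∎
    where n = suc m ∸ lo

  sumRange-distribʳ-* : ∀ lo m x f → sumRange lo m (λ l → f l * x) ≈ sumRange lo m f * x
  sumRange-distribʳ-* lo m x f = begin
    sumRange lo m (λ l → f l * x) ≡⟨ sumFrom≡Σ lo n (λ l → f l * x) ⟩
    Σ n (λ t → f (lo ℕ.+ t) * x)  ≈⟨ Σ-distribʳ-* n x (λ t → f (lo ℕ.+ t)) ⟩
    Σ n (λ t → f (lo ℕ.+ t)) * x  ≡⟨ ≡.cong (_* x) (sumFrom≡Σ lo n f) ⟨
    sumRange lo m f * x           ∎
    where n = suc m ∸ lo

  sumRange-snoc : ∀ lo m f → lo ≤ suc m → sumRange lo (suc m) f ≈ sumRange lo m f + f (suc m)
  sumRange-snoc lo m f lo≤1+m = begin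
    sumRange lo (suc m) f             ≡⟨ sumFrom≡Σ lo (suc (suc m) ∸ lo) f ⟩
    Σ (suc (suc m) ∸ lo) g            ≡⟨ ≡.cong (λ n → Σ n g) (ℕₚ.+-∸-assoc 1 lo≤1+m) ⟩
    Σ (suc (suc m ∸ lo)) g            ≈⟨ Σ-snoc (suc m ∸ lo) g ⟩
    Σ (suc m ∸ lo) g + g (suc m ∸ lo) ≈⟨ +-cong (reflexive (≡.sym (sumFrom≡Σ lo (suc m ∸ lo) f))) (reflexive (≡.cong f (ℕₚ.m+[n∸m]≡n lo≤1+m))) ⟩
    sumRange lo m f + f (suc m)       ∎
    where
    g : ℕ → Carrier
    g t = f (lo ℕ.+ t)

  incrSum-empty : ∀ f k lo m → m < lo → incrSum (suc k) lo m f ≈ 0#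
  incrSum-empty f k lo m m<lo = reflexive (≡.cong (λ n → sumFrom lo n (λ l → f l * incrSum k (suc l) m f)) (ℕₚ.m≤n⇒m∸n≡0 m<lo))

  incrSum-snoc : ∀ f k lo m → lo ≤ suc m →
                 incrSum (suc k) lo (suc m) f ≈ incrSum (suc k) lo m f + incrSum k lo m f * f (suc m)
  incrSum-snoc f zero lo m lo≤1+m = trans (sumRange-snoc lo m _ lo≤1+m) (+-congˡ (*-comm _ _))
  incrSum-snoc f (suc k) lo m lo≤1+m = begin
    sumRange lo (suc m) (λ l → f l * incrSum (suc k) (suc l) (suc m) f)
      ≈⟨ sumRange-snoc lo m _ lo≤1+m ⟩
    sumRange lo m (λ l → f l * incrSum (suc k) (suc l) (suc m) f) + f (suc m) * incrSum (suc k) (suc (suc m)) (suc m) f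
      ≈⟨ +-cong (sumRange-cong lo m (λ l _ l≤m → trans (*-congˡ (incrSum-snoc f k (suc l) m (s≤s l≤m))) (distribˡ _ _ _)))
                (trans (*-congˡ (incrSum-empty f k (suc (suc m)) (suc m) ℕₚ.≤-refl)) (zeroʳ _)) ⟩
    sumRange lo m (λ l → f l * incrSum (suc k) (suc l) m f + f l * (incrSum k (suc l) m f * f (suc m))) + 0#
      ≈⟨ +-identityʳ _ ⟩
    sumRange lo m (λ l → f l * incrSum (suc k) (suc l) m f + f l * (incrSum k (suc l) m f * f (suc m)))
      ≈⟨ sumRange-cong lo m (λ l _ _ → +-congˡ (sym (*-assoc _ _ _))) ⟩
    sumRange lo m (λ l → f l * incrSum (suc k) (suc l) m f + (f l * incrSum k (suc l) m f) * f (suc m))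
      ≈⟨ sumRange-distrib-+ lo m _ _ ⟩
    incrSum (suc (suc k)) lo m f + sumRange lo m (λ l → (f l * incrSum k (suc l) m f) * f (suc m))
      ≈⟨ +-congˡ (sumRange-distribʳ-* lo m _ _) ⟩
    incrSum (suc (suc k)) lo m f + incrSum (suc k) lo m f * f (suc m) ∎

  xShift : (ℕ → Carrier) → ℕ → Carrier
  xShift p zero = 0#
  xShift p (suc k) = p k

  xShift-cong : ∀ {p q} → (∀ i → p i ≈ q i) → ∀ k → xShift p k ≈ xShift q k
  xShift-cong p≈q zero = refl
  xShift-cong p≈q (suc k) = p≈q k

  -- linearProduct a b m k is the coefficient of xᵏ in ∏_{t<m} (b t + a t x).
  linearProduct : (a b : ℕ → Carrier) → ℕ → ℕ → Carrier
  linearProduct a b zero zero = 1#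
  linearProduct a b zero (suc k) = 0#
  linearProduct a b (suc m) k = b m * linearProduct a b m k + a m * xShift (linearProduct a b m) k

  linearProduct-cong : ∀ {a a′ b b′} → (∀ t → a t ≈ a′ t) → (∀ t → b t ≈ b′ t) →
                       ∀ m k → linearProduct a b m k ≈ linearProduct a′ b′ m k
  linearProduct-cong a≈a′ b≈b′ zero zero = refl
  linearProduct-cong a≈a′ b≈b′ zero (suc k) = refl
  linearProduct-cong a≈a′ b≈b′ (suc m) k =
    +-cong (*-cong (b≈b′ m) (linearProduct-cong a≈a′ b≈b′ m k))
           (*-cong (a≈a′ m) (xShift-cong (linearProduct-cong a≈a′ b≈b′ m) k))

  linearProduct-vanishes : ∀ a b {m k} → m < k → linearProduct a b m k ≈ 0#
  linearProduct-vanishes a b {zero} {suc k} _ = refl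
  linearProduct-vanishes a b {suc m} {suc k} (s≤s m<k) = begin
    b m * linearProduct a b m (suc k) + a m * linearProduct a b m k
      ≈⟨ +-cong (*-congˡ (linearProduct-vanishes a b (ℕₚ.m<n⇒m<1+n m<k))) (*-congˡ (linearProduct-vanishes a b m<k)) ⟩
    b m * 0# + a m * 0#  ≈⟨ +-cong (zeroʳ _) (zeroʳ _) ⟩
    0# + 0#              ≈⟨ +-identityʳ 0# ⟩
    0#                   ∎

  one : ℕ → Carrier
  one _ = 1#

  linearProduct-*-prod : ∀ a b m k → linearProduct a one m k * prod m b ≈ linearProduct (λ t → a t * b t) b m k
  linearProduct-*-prod a b zero zero = *-identityˡ 1#
  linearProduct-*-prod a b zero (suc k) = zeroˡ 1#
  linearProduct-*-prod a b (suc m) k = begin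
    (1# * L k + a m * xShift L k) * (prod m b * b m)
      ≈⟨ solve 5 (λ L X a P b → (con (ℤ.+ 1) :* L :+ a :* X) :* (P :* b) := b :* (L :* P) :+ (a :* b) :* (X :* P))
               refl (L k) (xShift L k) (a m) (prod m b) (b m) ⟩
    b m * (L k * prod m b) + (a m * b m) * (xShift L k * prod m b)
      ≈⟨ +-cong (*-congˡ (linearProduct-*-prod a b m k)) (*-congˡ (shifted k)) ⟩
    b m * linearProduct (λ t → a t * b t) b m k + (a m * b m) * xShift (linearProduct (λ t → a t * b t) b m) k ∎
    where
    L = linearProduct a one m
    shifted : ∀ k → xShift L k * prod m b ≈ xShift (linearProduct (λ t → a t * b t) b m) k
    shifted zero = zeroˡ _
    shifted (suc k) = linearProduct-*-prod a b m k

  incrSum≈linearProduct : ∀ f m k → incrSum k 1 m f ≈ linearProduct (λ t → f (suc t)) one m k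
  incrSum≈linearProduct f zero zero = refl
  incrSum≈linearProduct f zero (suc k) = refl
  incrSum≈linearProduct f (suc m) zero = begin
    1#                        ≈⟨ incrSum≈linearProduct f m zero ⟩
    L 0                       ≈⟨ *-identityˡ _ ⟨
    1# * L 0                  ≈⟨ +-identityʳ _ ⟨
    1# * L 0 + 0#             ≈⟨ +-congˡ (zeroʳ _) ⟨
    1# * L 0 + f (suc m) * 0# ∎
    where L = linearProduct (λ t → f (suc t)) one m
  incrSum≈linearProduct f (suc m) (suc k) = begin
    incrSum (suc k) 1 (suc m) f                         ≈⟨ incrSum-snoc f k 1 m (s≤s z≤n) ⟩
    incrSum (suc k) 1 m f + incrSum k 1 m f * f (suc m) ≈⟨ +-cong (incrSum≈linearProduct f m (suc k)) (*-congʳ (incrSum≈linearProduct f m k)) ⟩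
    L (suc k) + L k * f (suc m)                         ≈⟨ +-cong (*-identityˡ _) (*-comm _ _) ⟨
    1# * L (suc k) + f (suc m) * L k                    ∎
    where L = linearProduct (λ t → f (suc t)) one m

  module GaussianBinomial (p : Carrier) where

    gauss : ℕ → ℕ → Carrier
    gauss m zero = 1#
    gauss zero (suc i) = 0#
    gauss (suc m) (suc i) = gauss m (suc i) + p ^ (m ∸ i) * gauss m i

    gauss-vanishes : ∀ {m i} → m < i → gauss m i ≈ 0#
    gauss-vanishes {zero} {suc i} _ = refl
    gauss-vanishes {suc m} {suc i} (s≤s m<i) =
      trans (+-cong (gauss-vanishes (ℕₚ.m<n⇒m<1+n m<i)) (trans (*-congˡ (gauss-vanishes m<i)) (zeroʳ _))) (+-identityˡ _)

    ⟨p⟩ : ℕ → Carrier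
    ⟨p⟩ n = qPoch p p n

    gauss-*-qPoch : ∀ m i e → i ℕ.+ e ≡ m → gauss m i * (⟨p⟩ i * ⟨p⟩ e) ≈ ⟨p⟩ m
    gauss-*-qPoch zero zero zero _ = trans (*-identityˡ _) (*-identityˡ _)
    gauss-*-qPoch (suc m) zero e ≡.refl = trans (*-identityˡ _) (*-identityˡ _)
    gauss-*-qPoch (suc m) (suc i) e 1+i+e≡1+m = begin
      (gauss m (suc i) + p ^ (m ∸ i) * gauss m i) * (⟨p⟩ (suc i) * ⟨p⟩ e)
        ≈⟨ distribʳ _ _ _ ⟩
      gauss m (suc i) * (⟨p⟩ (suc i) * ⟨p⟩ e) + (p ^ (m ∸ i) * gauss m i) * (⟨p⟩ (suc i) * ⟨p⟩ e)
        ≈⟨ +-cong (left e 1+i+e≡1+m) right ⟩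
      ⟨p⟩ m * (1# - p ^ e) + (p ^ e * ⟨p⟩ m) * (1# - p ^ suc i)
        ≈⟨ solve 3 (λ Q a b → Q :* (con (ℤ.+ 1) :- a) :+ (a :* Q) :* (con (ℤ.+ 1) :- b) := Q :* (con (ℤ.+ 1) :- a :* b)) refl (⟨p⟩ m) (p ^ e) (p ^ suc i) ⟩
      ⟨p⟩ m * (1# - p ^ e * p ^ suc i)
        ≈⟨ *-congˡ (+-congˡ (-‿cong (trans (sym (^-homo-* p e (suc i))) (^-congʳ p (≡.trans (ℕₚ.+-comm e (suc i)) 1+i+e≡1+m))))) ⟩
      ⟨p⟩ m * (1# - p ^ suc m) ∎
      where
      i+e≡m : i ℕ.+ e ≡ m
      i+e≡m = ℕₚ.suc-injective 1+i+e≡1+m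
      left : ∀ e → suc i ℕ.+ e ≡ suc m → gauss m (suc i) * (⟨p⟩ (suc i) * ⟨p⟩ e) ≈ ⟨p⟩ m * (1# - p ^ e)
      left zero 1+i+0≡1+m = begin
        gauss m (suc i) * (⟨p⟩ (suc i) * 1#) ≈⟨ *-congʳ (gauss-vanishes (s≤s (ℕₚ.≤-reflexive m≡i))) ⟩
        0# * (⟨p⟩ (suc i) * 1#)              ≈⟨ zeroˡ _ ⟩
        0#                                   ≈⟨ zeroʳ _ ⟨
        ⟨p⟩ m * 0#                           ≈⟨ *-congˡ (-‿inverseʳ 1#) ⟨
        ⟨p⟩ m * (1# - 1#)                    ∎
        where
        m≡i : m ≡ i
        m≡i = ≡.trans (≡.sym (ℕₚ.suc-injective 1+i+0≡1+m)) (ℕₚ.+-identityʳ i)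
      left (suc e) 1+i+e≡1+m = begin
        gauss m (suc i) * (⟨p⟩ (suc i) * (⟨p⟩ e * (1# - p ^ suc e)))
          ≈⟨ solve 4 (λ B a b c → B :* (a :* (b :* c)) := (B :* (a :* b)) :* c) refl (gauss m (suc i)) (⟨p⟩ (suc i)) (⟨p⟩ e) (1# - p ^ suc e) ⟩
        (gauss m (suc i) * (⟨p⟩ (suc i) * ⟨p⟩ e)) * (1# - p ^ suc e)
          ≈⟨ *-congʳ (gauss-*-qPoch m (suc i) e (≡.trans (≡.sym (ℕₚ.+-suc i e)) (ℕₚ.suc-injective 1+i+e≡1+m))) ⟩
        ⟨p⟩ m * (1# - p ^ suc e) ∎
      right : (p ^ (m ∸ i) * gauss m i) * (⟨p⟩ (suc i) * ⟨p⟩ e) ≈ (p ^ e * ⟨p⟩ m) * (1# - p ^ suc i)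
      right = begin
        (p ^ (m ∸ i) * gauss m i) * ((⟨p⟩ i * (1# - p ^ suc i)) * ⟨p⟩ e)
          ≈⟨ *-congʳ (*-congʳ (^-congʳ p (≡.trans (≡.cong (_∸ i) (≡.sym i+e≡m)) (ℕₚ.m+n∸m≡n i e)))) ⟩
        (p ^ e * gauss m i) * ((⟨p⟩ i * (1# - p ^ suc i)) * ⟨p⟩ e)
          ≈⟨ solve 5 (λ a B Q c E → (a :* B) :* ((Q :* c) :* E) := (a :* (B :* (Q :* E))) :* c) refl (p ^ e) (gauss m i) (⟨p⟩ i) (1# - p ^ suc i) (⟨p⟩ e) ⟩
        (p ^ e * (gauss m i * (⟨p⟩ i * ⟨p⟩ e))) * (1# - p ^ suc i)
          ≈⟨ *-congʳ (*-congˡ (gauss-*-qPoch m i e i+e≡m)) ⟩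
        (p ^ e * ⟨p⟩ m) * (1# - p ^ suc i) ∎

    qBinom≈gauss : (∀ t → ¬ (1# - p ^ suc t ≈ 0#)) → ∀ m i → qBinom p m i ≈ gauss m i
    qBinom≈gauss 1-p^t≉0 m i with i ℕ.≤ᵇ m in i≤ᵇm
    ... | true = sym (x*y≈z⇒x≈z*y⁻¹ (x*y≉0 (⟨p⟩≉0 i) (⟨p⟩≉0 (m ∸ i))) (gauss-*-qPoch m i (m ∸ i) (ℕₚ.m+[n∸m]≡n i≤m)))
      where
      ⟨p⟩≉0 : ∀ n → ¬ (⟨p⟩ n ≈ 0#)
      ⟨p⟩≉0 n = prod≉0 n _ 1-p^t≉0
      i≤m : i ≤ m
      i≤m = ℕₚ.≤ᵇ⇒≤ i m (≡.subst Bool.T (≡.sym i≤ᵇm) _)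
    ... | false = sym (gauss-vanishes {m} {i} (ℕₚ.≰⇒> (λ i≤m → ≡.subst Bool.T i≤ᵇm (ℕₚ.≤⇒≤ᵇ i≤m))))

    geometric : Carrier → ℕ → Carrier
    geometric r t = r * p ^ t

    linearProduct-geometric : ∀ r m i → linearProduct (geometric r) one m i ≈ gauss m i * prod i (geometric r)
    linearProduct-geometric r zero zero = sym (*-identityˡ _)
    linearProduct-geometric r zero (suc i) = sym (zeroˡ _)
    linearProduct-geometric r (suc m) zero = begin
      1# * linearProduct α one m 0 + α m * 0# ≈⟨ +-cong (*-identityˡ _) (zeroʳ _) ⟩
      linearProduct α one m 0 + 0#            ≈⟨ +-identityʳ _ ⟩
      linearProduct α one m 0                 ≈⟨ linearProduct-geometric r m zero ⟩
      1# * 1#                                 ∎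
      where α = geometric r
    linearProduct-geometric r (suc m) (suc i) = begin
      1# * linearProduct α one m (suc i) + α m * linearProduct α one m i
        ≈⟨ +-cong (trans (*-identityˡ _) (linearProduct-geometric r m (suc i))) (*-congˡ (linearProduct-geometric r m i)) ⟩
      gauss m (suc i) * (prod i α * α i) + α m * (gauss m i * prod i α)
        ≈⟨ +-congˡ (exchange (i ℕ.≤? m)) ⟩
      gauss m (suc i) * (prod i α * α i) + (p ^ (m ∸ i) * gauss m i) * (prod i α * α i)
        ≈⟨ distribʳ _ _ _ ⟨
      (gauss m (suc i) + p ^ (m ∸ i) * gauss m i) * (prod i α * α i) ∎
      where
      α = geometric r
      exchange : Dec (i ≤ m) → α m * (gauss m i * prod i α) ≈ (p ^ (m ∸ i) * gauss m i) * (prod i α * α i)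
      exchange (yes i≤m) = begin
        (r * p ^ m) * (gauss m i * prod i α)
          ≈⟨ *-congʳ (*-congˡ (trans (^-congʳ p (≡.sym (ℕₚ.m∸n+n≡m i≤m))) (^-homo-* p (m ∸ i) i))) ⟩
        (r * (p ^ (m ∸ i) * p ^ i)) * (gauss m i * prod i α)
          ≈⟨ solve 5 (λ r a b B G → (r :* (a :* b)) :* (B :* G) := (a :* B) :* (G :* (r :* b))) refl r (p ^ (m ∸ i)) (p ^ i) (gauss m i) (prod i α) ⟩
        (p ^ (m ∸ i) * gauss m i) * (prod i α * (r * p ^ i)) ∎
      exchange (no i≰m) = begin
        α m * (gauss m i * prod i α)                 ≈⟨ *-congˡ (*-congʳ (gauss-vanishes (ℕₚ.≰⇒> i≰m))) ⟩
        α m * (0# * prod i α)                        ≈⟨ trans (*-congˡ (zeroˡ _)) (zeroʳ _) ⟩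
        0#                                           ≈⟨ trans (*-congʳ (zeroʳ _)) (zeroˡ _) ⟨
        (p ^ (m ∸ i) * 0#) * (prod i α * α i)        ≈⟨ *-congʳ (*-congˡ (gauss-vanishes (ℕₚ.≰⇒> i≰m))) ⟨
        (p ^ (m ∸ i) * gauss m i) * (prod i α * α i) ∎

  module LucasExpansion (σ : Carrier) (σσ≈1 : σ * σ ≈ 1#) (α : ℕ → Carrier) where

    τ : Carrier
    τ = - σ

    ττ≈1 : τ * τ ≈ 1#
    ττ≈1 = trans (sym (-‿distribˡ-* _ _)) (trans (-‿cong (sym (-‿distribʳ-* _ _))) (trans (-‿involutive _) σσ≈1))

    [τ+τ]*[τ*x]≈x+x : ∀ x → (τ + τ) * (τ * x) ≈ x + x
    [τ+τ]*[τ*x]≈x+x x = trans (distribʳ _ _ _) (+-cong τ*[τ*x]≈x τ*[τ*x]≈x)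
      where τ*[τ*x]≈x = trans (sym (*-assoc _ _ _)) (trans (*-congʳ ττ≈1) (*-identityˡ x))

    P : ℕ → ℕ → Carrier
    P = linearProduct α one

    P-vanishes : ∀ {m i} → m < i → P m i ≈ 0#
    P-vanishes = linearProduct-vanishes α one

    P-step : ∀ m i → P (suc m) i ≈ P m i + α m * xShift (P m) i
    P-step m i = +-congʳ (*-identityˡ _)

    -- S m d is the coefficient of yᵈ in P(y) P(y⁻¹), where P(y) = ∏_{t<m} (1 + α t y).
    S : ℕ → ℕ → Carrier
    S m d = Σ (suc m) (λ i → P m i * P m (i ℕ.+ d))

    S⁻ : ℕ → ℕ → Carrier
    S⁻ m zero = S m 1
    S⁻ m (suc d) = S m d

    S-truncate : ∀ m N d → suc m ≤ N → Σ N (λ i → P m i * P m (i ℕ.+ d)) ≈ S m d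
    S-truncate m N d 1+m≤N = Σ-truncate (suc m) N _ 1+m≤N (λ i m<i → trans (*-congʳ (P-vanishes m<i)) (zeroˡ _))

    S-vanishes : ∀ {m d} → m < d → S m d ≈ 0#
    S-vanishes {m} {d} m<d = Σ-zero (suc m) (λ i _ → trans (*-congˡ (P-vanishes (ℕₚ.<-≤-trans m<d (ℕₚ.m≤n+m d i)))) (zeroʳ _))

    S-step : ∀ m d → S (suc m) d ≈ ((1# + α m * α m) * S m d + α m * S m (suc d)) + α m * S⁻ m d
    S-step m d = begin
      S (suc m) d
        ≈⟨ Σ-cong N (λ i → *-cong (P-step m i) (P-step m (i ℕ.+ d))) ⟩
      Σ N (λ i → (P m i + a * X i) * (P m (i ℕ.+ d) + a * X (i ℕ.+ d)))
        ≈⟨ Σ-cong N (λ i → expand (P m i) (X i) (P m (i ℕ.+ d)) (X (i ℕ.+ d))) ⟩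
      Σ N (λ i → ((T₁ i + (a * a) * T₂ i) + a * T₃ i) + a * T₄ i)
        ≈⟨ trans (Σ-distrib-+ N _ _) (+-cong (Σ-distrib-+ N _ _) (Σ-distribˡ-* N a T₄)) ⟩
      (Σ N (λ i → T₁ i + (a * a) * T₂ i) + Σ N (λ i → a * T₃ i)) + a * Σ N T₄
        ≈⟨ +-congʳ (+-cong (Σ-distrib-+ N _ _) (Σ-distribˡ-* N a T₃)) ⟩
      ((Σ N T₁ + Σ N (λ i → (a * a) * T₂ i)) + a * Σ N T₃) + a * Σ N T₄
        ≈⟨ +-cong (+-cong (+-cong (S-truncate m N d (ℕₚ.n≤1+n _)) (trans (Σ-distribˡ-* N (a * a) T₂) (*-congˡ ΣT₂)))
                          (*-congˡ ΣT₃))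
                  (*-congˡ (ΣT₄ d)) ⟩
      ((S m d + (a * a) * S m d) + a * S m (suc d)) + a * S⁻ m d
        ≈⟨ +-congʳ (+-congʳ (+-congʳ (*-identityˡ _))) ⟨
      ((1# * S m d + (a * a) * S m d) + a * S m (suc d)) + a * S⁻ m d
        ≈⟨ +-congʳ (+-congʳ (distribʳ _ _ _)) ⟨
      ((1# + a * a) * S m d + a * S m (suc d)) + a * S⁻ m d ∎
      where
      N = suc (suc m)
      a = α m
      X = xShift (P m)
      T₁ T₂ T₃ T₄ : ℕ → Carrier
      T₁ i = P m i * P m (i ℕ.+ d)
      T₂ i = X i * X (i ℕ.+ d)
      T₃ i = X i * P m (i ℕ.+ d)
      T₄ i = P m i * X (i ℕ.+ d)
      expand : ∀ x y u v → (x + a * y) * (u + a * v) ≈ (((x * u) + (a * a) * (y * v)) + a * (y * u)) + a * (x * v)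
      expand = solve 5 (λ a x y u v → (x :+ a :* y) :* (u :+ a :* v) := (((x :* u) :+ (a :* a) :* (y :* v)) :+ a :* (y :* u)) :+ a :* (x :* v)) refl a
      dropFirst : ∀ {f} → f 0 ≈ 0# → Σ N f ≈ Σ (suc m) (λ i → f (suc i))
      dropFirst f0≈0 = trans (reflexive (Σ-suc (suc m) _)) (trans (+-congʳ f0≈0) (+-identityˡ _))
      ΣT₂ : Σ N T₂ ≈ S m d
      ΣT₂ = dropFirst (zeroˡ _)
      ΣT₃ : Σ N T₃ ≈ S m (suc d)
      ΣT₃ = trans (dropFirst (zeroˡ _)) (Σ-cong (suc m) (λ i → reflexive (≡.cong (λ j → P m i * P m j) (≡.sym (ℕₚ.+-suc i d)))))
      ΣT₄ : ∀ d → Σ N (λ i → P m i * X (i ℕ.+ d)) ≈ S⁻ m d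
      ΣT₄ zero = begin
        Σ N (λ i → P m i * X (i ℕ.+ 0))       ≈⟨ Σ-cong N (λ i → reflexive (≡.cong (λ j → P m i * X j) (ℕₚ.+-identityʳ i))) ⟩
        Σ N (λ i → P m i * X i)               ≈⟨ dropFirst (zeroʳ _) ⟩
        Σ (suc m) (λ i → P m (suc i) * P m i) ≈⟨ Σ-cong (suc m) (λ i → trans (*-comm _ _) (reflexive (≡.cong (λ j → P m i * P m j) (ℕₚ.+-comm 1 i)))) ⟩
        S m 1                                 ∎
      ΣT₄ (suc d) = trans (Σ-cong N (λ i → reflexive (≡.cong (λ j → P m i * X j) (ℕₚ.+-suc i d)))) (S-truncate m N d (ℕₚ.n≤1+n _))

    -- Write (1 − σ a)² + a x = (1 + a y)(1 + a y⁻¹) with y + y⁻¹ = x + 2τ.  Then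
    -- lucasCoeff d k is the coefficient of xᵏ in ℓ_d, where ℓ₀ = 1 and ℓ_d = yᵈ + y⁻ᵈ for d ≥ 1;
    -- substituting z = τ y in the identity behind Lucas.lucas gives ℓ_d = Σₖ τᵈ⁺ᵏ lucas d k xᵏ.
    lucasCoeff : ℕ → ℕ → Carrier
    lucasCoeff zero zero = 1#
    lucasCoeff zero (suc k) = 0#
    lucasCoeff (suc d) k = τ ^ (suc d ℕ.+ k) * fromℕ (Lucas.lucas (suc d) k)

    -- The coefficient of xᵏ in yᵈ⁻¹ + y¹⁻ᵈ for d ≥ 1 (so 2 ℓ₀ when d = 1), and 0 for d = 0.
    lucasCoeff⁻ : ℕ → ℕ → Carrier
    lucasCoeff⁻ zero k = 0#
    lucasCoeff⁻ (suc d) k = τ ^ (d ℕ.+ k) * fromℕ (Lucas.lucas d k)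

    lucasCoeff-vanishes : ∀ {d k} → d < k → lucasCoeff d k ≈ 0#
    lucasCoeff-vanishes {zero} {suc k} _ = refl
    lucasCoeff-vanishes {suc d} d<k = trans (*-congˡ (reflexive (≡.cong fromℕ (Lucas.lucas-vanishes d<k)))) (zeroʳ _)

    lucasCoeff⁻-one : ∀ k → lucasCoeff⁻ 1 k ≈ lucasCoeff 0 k + lucasCoeff 0 k
    lucasCoeff⁻-one zero = solve 0 (con (ℤ.+ 1) :* (con (ℤ.+ 1) :+ (con (ℤ.+ 1) :+ con (ℤ.+ 0))) := con (ℤ.+ 1) :+ con (ℤ.+ 1)) refl
    lucasCoeff⁻-one (suc k) = trans (*-congˡ (reflexive (≡.cong fromℕ (Lucas.lucas-vanishes {0} {suc k} (s≤s z≤n)))))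
                                     (trans (zeroʳ _) (sym (+-identityʳ 0#)))

    -- (x + 2τ) ℓ_d = ℓ_{d+1} + ℓ_{d−1}, coefficientwise.
    lucasCoeff-recurrence : ∀ d k → lucasCoeff (suc d) k + lucasCoeff⁻ d k ≈ (τ + τ) * lucasCoeff d k + xShift (lucasCoeff d) k
    lucasCoeff-recurrence zero zero = solve 1 (λ t → (t :* con (ℤ.+ 1)) :* (con (ℤ.+ 1) :+ (con (ℤ.+ 1) :+ con (ℤ.+ 0))) :+ con (ℤ.+ 0)
                                                := (t :+ t) :* con (ℤ.+ 1) :+ con (ℤ.+ 0)) refl τ
    lucasCoeff-recurrence zero (suc zero) = begin
      (τ * (τ * 1#)) * (1# + 0#) + 0# ≈⟨ solve 1 (λ t → (t :* (t :* con (ℤ.+ 1))) :* (con (ℤ.+ 1) :+ con (ℤ.+ 0)) :+ con (ℤ.+ 0) := t :* t) refl τ ⟩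
      τ * τ                           ≈⟨ ττ≈1 ⟩
      1#                              ≈⟨ solve 1 (λ t → con (ℤ.+ 1) := (t :+ t) :* con (ℤ.+ 0) :+ con (ℤ.+ 1)) refl τ ⟩
      (τ + τ) * 0# + 1#               ∎
    lucasCoeff-recurrence zero (suc (suc k)) = begin
      lucasCoeff 1 (suc (suc k)) + 0# ≈⟨ trans (+-identityʳ _) (lucasCoeff-vanishes {1} {suc (suc k)} (s≤s (s≤s z≤n))) ⟩
      0#                              ≈⟨ solve 1 (λ t → con (ℤ.+ 0) := (t :+ t) :* con (ℤ.+ 0) :+ con (ℤ.+ 0)) refl τ ⟩
      (τ + τ) * 0# + 0#               ∎
    lucasCoeff-recurrence (suc d) zero = begin
      τ ^ (2 ℕ.+ (d ℕ.+ 0)) * fromℕ 2 + T * fromℕ 2 ≈⟨ +-congʳ (*-congʳ (^-involution ττ≈1 (d ℕ.+ 0))) ⟩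
      T * fromℕ 2 + T * fromℕ 2                     ≈⟨ [τ+τ]*[τ*x]≈x+x (T * fromℕ 2) ⟨
      (τ + τ) * (τ * (T * fromℕ 2))                 ≈⟨ *-congˡ (*-assoc _ _ _) ⟨
      (τ + τ) * ((τ * T) * fromℕ 2)                 ≈⟨ +-identityʳ _ ⟨
      (τ + τ) * ((τ * T) * fromℕ 2) + 0#            ∎
      where T = τ ^ (d ℕ.+ 0)
    lucasCoeff-recurrence (suc d) (suc k) = begin
      τ ^ (2 ℕ.+ (d ℕ.+ suc k)) * fromℕ L₂ + T * fromℕ B  ≈⟨ +-congʳ (*-congʳ (^-involution ττ≈1 (d ℕ.+ suc k))) ⟩
      T * fromℕ L₂ + T * fromℕ B                          ≈⟨ trans (sym (distribˡ _ _ _)) (*-congˡ (sym (fromℕ-homo-+ L₂ B))) ⟩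
      T * fromℕ (L₂ ℕ.+ B)                                ≡⟨ ≡.cong (λ n → T * fromℕ n) (Lucas.lucas-recurrence d k) ⟩
      T * fromℕ (2 ℕ.* L₁ ℕ.+ L₀)                        ≈⟨ *-congˡ (trans (fromℕ-homo-+ (2 ℕ.* L₁) L₀) (+-congʳ (fromℕ-homo-* 2 L₁))) ⟩
      T * (fromℕ 2 * fromℕ L₁ + fromℕ L₀)                ≈⟨ solve 3 (λ T l₁ l₀ → T :* ((con (ℤ.+ 1) :+ (con (ℤ.+ 1) :+ con (ℤ.+ 0))) :* l₁ :+ l₀)
                                                                 := (T :* l₁ :+ T :* l₁) :+ T :* l₀) refl T (fromℕ L₁) (fromℕ L₀) ⟩
      (T * fromℕ L₁ + T * fromℕ L₁) + T * fromℕ L₀       ≈⟨ +-cong (trans (sym ([τ+τ]*[τ*x]≈x+x _)) (*-congˡ (sym (*-assoc _ _ _))))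
                                                                   (*-congʳ (^-congʳ τ (ℕₚ.+-suc d k))) ⟩
      (τ + τ) * ((τ * T) * fromℕ L₁) + τ ^ (suc d ℕ.+ k) * fromℕ L₀ ∎
      where
      T = τ ^ (d ℕ.+ suc k)
      L₂ = Lucas.lucas (2 ℕ.+ d) (suc k)
      B = Lucas.lucas d (suc k)
      L₁ = Lucas.lucas (suc d) (suc k)
      L₀ = Lucas.lucas (suc d) k

    -- Shift d by one in each sum; the terms at d = 0 match because lucasCoeff⁻ 1 = 2 ℓ₀.
    Σ-reindex : ∀ m N k → S m (suc N) ≈ 0# → S m (suc (suc N)) ≈ 0# →
      Σ (suc (suc N)) (λ d → S m (suc d) * lucasCoeff d k) + Σ (suc (suc N)) (λ d → S⁻ m d * lucasCoeff d k)
      ≈ Σ (suc (suc N)) (λ d → S m d * lucasCoeff (suc d) k) + Σ (suc (suc N)) (λ d → S m d * lucasCoeff⁻ d k)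
    Σ-reindex m N k S[1+N]≈0 S[2+N]≈0 = begin
      Σ (suc (suc N)) (λ d → S m (suc d) * ℓₖ d) + Σ (suc (suc N)) (λ d → S⁻ m d * ℓₖ d)
        ≡⟨ ≡.cong₂ _+_ (Σ-suc (suc N) (λ d → S m (suc d) * ℓₖ d)) (Σ-suc (suc N) (λ d → S⁻ m d * ℓₖ d)) ⟩
      (B + Σ (suc N) (λ d → S m (suc (suc d)) * ℓₖ (suc d))) + (B + V)
        ≈⟨ +-congʳ (+-congˡ (trans (Σ-snoc N _) (trans (+-congˡ (trans (*-congʳ S[2+N]≈0) (zeroˡ _))) (+-identityʳ _)))) ⟩
      (B + W) + (B + V)
        ≈⟨ solve 3 (λ B W V → (B :+ W) :+ (B :+ V) := V :+ (con (ℤ.+ 0) :+ ((B :+ B) :+ W))) refl B W V ⟩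
      V + (0# + ((B + B) + W))
        ≈⟨ +-cong (sym (trans (Σ-snoc (suc N) _) (trans (+-congˡ (trans (*-congʳ S[1+N]≈0) (zeroˡ _))) (+-identityʳ _))))
                  (+-cong (sym (zeroʳ _)) (+-congʳ (sym (trans (*-congˡ (lucasCoeff⁻-one k)) (distribˡ _ _ _))))) ⟩
      Σ (suc (suc N)) (λ d → S m d * ℓₖ (suc d)) + (S m 0 * 0# + (S m 1 * lucasCoeff⁻ 1 k + W))
        ≡⟨ ≡.cong (Σ (suc (suc N)) (λ d → S m d * ℓₖ (suc d)) +_)
                  (≡.trans (Σ-suc (suc N) (λ d → S m d * lucasCoeff⁻ d k)) (≡.cong (S m 0 * 0# +_) (Σ-suc N _))) ⟨
      Σ (suc (suc N)) (λ d → S m d * ℓₖ (suc d)) + Σ (suc (suc N)) (λ d → S m d * lucasCoeff⁻ d k) ∎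
      where
      ℓₖ : ℕ → Carrier
      ℓₖ d = lucasCoeff d k
      B = S m 1 * ℓₖ 0
      W = Σ N (λ d → S m (suc (suc d)) * ℓₖ (suc d))
      V = Σ (suc N) (λ d → S m d * ℓₖ (suc d))

    β : ℕ → Carrier
    β t = sq (1# - σ * α t)

    β-expand : ∀ t → β t ≈ (1# + α t * α t) + α t * (τ + τ)
    β-expand t = trans (solve 2 (λ s a → (con (ℤ.+ 1) :- s :* a) :* (con (ℤ.+ 1) :- s :* a)
                                   := (con (ℤ.+ 1) :+ (s :* s) :* (a :* a)) :+ a :* (:- s :+ :- s)) refl σ (α t))
                       (+-congʳ (+-congˡ (trans (*-congʳ σσ≈1) (*-identityˡ _))))

    linearProduct-lucas : ∀ m N k → m < N → linearProduct α β m k ≈ Σ N (λ d → S m d * lucasCoeff d k)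
    linearProduct-lucas zero (suc N) k _ = trans (constant k) (sym (begin
      Σ (suc N) (λ d → S 0 d * lucasCoeff d k)
        ≡⟨ Σ-suc N _ ⟩
      S 0 0 * lucasCoeff 0 k + Σ N (λ d → S 0 (suc d) * lucasCoeff (suc d) k)
        ≈⟨ +-cong (*-congʳ S₀₀≈1) (Σ-zero N (λ d _ → trans (*-congʳ (S-vanishes {0} {suc d} (s≤s z≤n))) (zeroˡ _))) ⟩
      1# * lucasCoeff 0 k + 0#
        ≈⟨ trans (+-identityʳ _) (*-identityˡ _) ⟩
      lucasCoeff 0 k ∎))
      where
      S₀₀≈1 = trans (+-identityʳ _) (*-identityˡ 1#)
      constant : ∀ k → linearProduct α β 0 k ≈ lucasCoeff 0 k
      constant zero = refl
      constant (suc k) = refl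
    linearProduct-lucas (suc m) (suc (suc N)) k (s≤s (s≤s m≤N)) = begin
      β m * G k + a * xShift G k
        ≈⟨ +-cong (*-cong (β-expand m) (IH k)) (*-congˡ (shiftedIH k)) ⟩
      ((1# + a * a) + a * (τ + τ)) * X + a * Σ NN (λ d → S m d * xShift (lucasCoeff d) k)
        ≈⟨ +-congˡ (*-congˡ (Σ-cong NN (λ d → *-congˡ (xShift-by-recurrence d)))) ⟩
      ((1# + a * a) + a * (τ + τ)) * X + a * Σ NN (λ d → S m d * ((lucasCoeff (suc d) k + lucasCoeff⁻ d k) - (τ + τ) * lucasCoeff d k))
        ≈⟨ +-congˡ (*-congˡ (Σ-cong NN (λ d → distribute (S m d) (lucasCoeff (suc d) k) (lucasCoeff⁻ d k) (lucasCoeff d k)))) ⟩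
      ((1# + a * a) + a * (τ + τ)) * X + a * Σ NN (λ d → (S m d * lucasCoeff (suc d) k + S m d * lucasCoeff⁻ d k) + (- (τ + τ)) * (S m d * lucasCoeff d k))
        ≈⟨ +-congˡ (*-congˡ (trans (Σ-distrib-+ NN _ _) (+-cong (Σ-distrib-+ NN _ _) (Σ-distribˡ-* NN _ _)))) ⟩
      ((1# + a * a) + a * (τ + τ)) * X + a * ((Y₁ + Y₂) + (- (τ + τ)) * X)
        ≈⟨ solve 4 (λ a t X Y → ((con (ℤ.+ 1) :+ a :* a) :+ a :* (t :+ t)) :* X :+ a :* (Y :+ (:- (t :+ t)) :* X)
                              := (con (ℤ.+ 1) :+ a :* a) :* X :+ a :* Y) refl a τ X (Y₁ + Y₂) ⟩
      (1# + a * a) * X + a * (Y₁ + Y₂)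
        ≈⟨ +-congˡ (*-congˡ (Σ-reindex m N k (S-vanishes (s≤s m≤N)) (S-vanishes (s≤s (ℕₚ.m≤n⇒m≤1+n m≤N))))) ⟨
      (1# + a * a) * X + a * (U + V)
        ≈⟨ solve 4 (λ c a U V → c :+ a :* (U :+ V) := (c :+ a :* U) :+ a :* V) refl ((1# + a * a) * X) a U V ⟩
      ((1# + a * a) * X + a * U) + a * V
        ≈⟨ ΣS[1+m] ⟨
      Σ NN (λ d → S (suc m) d * lucasCoeff d k) ∎
      where
      NN = suc (suc N)
      a = α m
      G = linearProduct α β m
      IH : ∀ k → G k ≈ Σ NN (λ d → S m d * lucasCoeff d k)
      IH k = linearProduct-lucas m NN k (ℕₚ.m≤n⇒m≤1+n (s≤s m≤N))
      shiftedIH : ∀ k → xShift G k ≈ Σ NN (λ d → S m d * xShift (lucasCoeff d) k)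
      shiftedIH zero = sym (Σ-zero NN (λ _ _ → zeroʳ _))
      shiftedIH (suc k) = IH k
      X = Σ NN (λ d → S m d * lucasCoeff d k)
      Y₁ = Σ NN (λ d → S m d * lucasCoeff (suc d) k)
      Y₂ = Σ NN (λ d → S m d * lucasCoeff⁻ d k)
      U = Σ NN (λ d → S m (suc d) * lucasCoeff d k)
      V = Σ NN (λ d → S⁻ m d * lucasCoeff d k)
      xShift-by-recurrence : ∀ d → xShift (lucasCoeff d) k ≈ (lucasCoeff (suc d) k + lucasCoeff⁻ d k) - (τ + τ) * lucasCoeff d k
      xShift-by-recurrence d = trans (solve 2 (λ x y → y := (x :+ y) :- x) refl ((τ + τ) * lucasCoeff d k) (xShift (lucasCoeff d) k))
                                     (+-congʳ (sym (lucasCoeff-recurrence d k)))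
      distribute : ∀ s x y z → s * ((x + y) - (τ + τ) * z) ≈ (s * x + s * y) + (- (τ + τ)) * (s * z)
      distribute = solve 5 (λ t s x y z → s :* ((x :+ y) :- (t :+ t) :* z) := (s :* x :+ s :* y) :+ (:- (t :+ t)) :* (s :* z)) refl τ
      ΣS[1+m] : Σ NN (λ d → S (suc m) d * lucasCoeff d k) ≈ ((1# + a * a) * X + a * U) + a * V
      ΣS[1+m] = begin
        Σ NN (λ d → S (suc m) d * lucasCoeff d k)
          ≈⟨ Σ-cong NN (λ d → *-congʳ (S-step m d)) ⟩
        Σ NN (λ d → (((1# + a * a) * S m d + a * S m (suc d)) + a * S⁻ m d) * lucasCoeff d k)
          ≈⟨ Σ-cong NN (λ d → solve 5 (λ a s s′ s″ c → (((con (ℤ.+ 1) :+ a :* a) :* s :+ a :* s′) :+ a :* s″) :* c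
                                                    := ((con (ℤ.+ 1) :+ a :* a) :* (s :* c) :+ a :* (s′ :* c)) :+ a :* (s″ :* c))
                                          refl a (S m d) (S m (suc d)) (S⁻ m d) (lucasCoeff d k)) ⟩
        Σ NN (λ d → ((1# + a * a) * (S m d * lucasCoeff d k) + a * (S m (suc d) * lucasCoeff d k)) + a * (S⁻ m d * lucasCoeff d k))
          ≈⟨ trans (Σ-distrib-+ NN _ _) (+-cong (trans (Σ-distrib-+ NN _ _) (+-cong (Σ-distribˡ-* NN _ _) (Σ-distribˡ-* NN _ _))) (Σ-distribˡ-* NN _ _)) ⟩
        ((1# + a * a) * X + a * U) + a * V ∎

    τ^[n+[n+t]]≈τ^t : ∀ n t → τ ^ (n ℕ.+ (n ℕ.+ t)) ≈ τ ^ t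
    τ^[n+[n+t]]≈τ^t zero t = refl
    τ^[n+[n+t]]≈τ^t (suc n) t = trans (^-congʳ τ (≡.cong suc (ℕₚ.+-suc n (n ℕ.+ t))))
                                       (trans (^-involution ττ≈1 (n ℕ.+ (n ℕ.+ t))) (τ^[n+[n+t]]≈τ^t n t))

    lucasCoeff-closed : ∀ {d k} → 0 < k → k ≤ d → ¬ (fromℕ k ≈ 0#) →
      lucasCoeff d k ≈ (τ ^ (d ∸ k) * (fromℕ d * fromℕ k ⁻¹)) * fromℕ ((d ℕ.+ k ∸ 1) C (2 ℕ.* k ∸ 1))
    lucasCoeff-closed {d} {suc K} _ 1+K≤d 1+K≉0 = ≡.subst
      (λ d → lucasCoeff d (suc K) ≈ (τ ^ t * (fromℕ d * fromℕ (suc K) ⁻¹)) * fromℕ ((d ℕ.+ suc K ∸ 1) C (2 ℕ.* suc K ∸ 1)))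
      (ℕₚ.m+[n∸m]≡n 1+K≤d) closed-form
      where
      t = d ∸ suc K
      L = Lucas.lucas (suc K ℕ.+ t) (suc K)
      B = suc (K ℕ.+ t ℕ.+ K) C suc (K ℕ.+ K)
      2[1+K]∸1≡1+2K : 2 ℕ.* suc K ∸ 1 ≡ suc (K ℕ.+ K)
      2[1+K]∸1≡1+2K = ≡.trans (≡.cong (λ n → K ℕ.+ suc n) (ℕₚ.+-identityʳ K)) (ℕₚ.+-suc K K)
      fromℕL : fromℕ L ≈ (fromℕ (suc K ℕ.+ t) * fromℕ B) * fromℕ (suc K) ⁻¹
      fromℕL = x*y≈z⇒x≈z*y⁻¹ 1+K≉0 (begin
        fromℕ L * fromℕ (suc K)       ≈⟨ *-comm _ _ ⟩
        fromℕ (suc K) * fromℕ L       ≈⟨ fromℕ-homo-* (suc K) L ⟨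
        fromℕ (suc K ℕ.* L)           ≡⟨ ≡.cong fromℕ (Lucas.lucas-closed (K ℕ.+ t) K) ⟩
        fromℕ (suc (K ℕ.+ t) ℕ.* B)   ≈⟨ fromℕ-homo-* (suc (K ℕ.+ t)) B ⟩
        fromℕ (suc K ℕ.+ t) * fromℕ B ∎)
      closed-form : lucasCoeff (suc K ℕ.+ t) (suc K)
                    ≈ (τ ^ t * (fromℕ (suc K ℕ.+ t) * fromℕ (suc K) ⁻¹)) * fromℕ ((suc K ℕ.+ t ℕ.+ suc K ∸ 1) C (2 ℕ.* suc K ∸ 1))
      closed-form = begin
        τ ^ ((suc K ℕ.+ t) ℕ.+ suc K) * fromℕ L
          ≈⟨ *-cong (trans (^-congʳ τ (ℕₚ.+-comm (suc K ℕ.+ t) (suc K))) (τ^[n+[n+t]]≈τ^t (suc K) t)) fromℕL ⟩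
        τ ^ t * ((fromℕ (suc K ℕ.+ t) * fromℕ B) * fromℕ (suc K) ⁻¹)
          ≈⟨ solve 4 (λ T a b c → T :* ((a :* b) :* c) := (T :* (a :* c)) :* b) refl (τ ^ t) (fromℕ (suc K ℕ.+ t)) (fromℕ B) (fromℕ (suc K) ⁻¹) ⟩
        (τ ^ t * (fromℕ (suc K ℕ.+ t) * fromℕ (suc K) ⁻¹)) * fromℕ B
          ≡⟨ ≡.cong₂ (λ n j → (τ ^ t * (fromℕ (suc K ℕ.+ t) * fromℕ (suc K) ⁻¹)) * fromℕ (n C j))
                     (≡.sym (ℕₚ.+-suc (K ℕ.+ t) K)) (≡.sym 2[1+K]∸1≡1+2K) ⟩
        (τ ^ t * (fromℕ (suc K ℕ.+ t) * fromℕ (suc K) ⁻¹)) * fromℕ ((suc K ℕ.+ t ℕ.+ suc K ∸ 1) C (2 ℕ.* suc K ∸ 1)) ∎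

    -- Grouping the terms P m i P m (i + d) lucasCoeff d k by the pair (i, j = i + d).
    Σ-by-pairs : ∀ m k → k ≤ m →
      Σ (suc m) (λ d → S m d * lucasCoeff d k)
        ≈ Σ (suc (m ∸ k)) (λ i → sumRange (i ℕ.+ k) m (λ j → (P m i * P m j) * lucasCoeff (j ∸ i) k))
    Σ-by-pairs m k k≤m = begin
      Σ (suc m) (λ d → S m d * lucasCoeff d k)
        ≈⟨ Σ-cong (suc m) (λ d → sym (Σ-distribʳ-* (suc m) (lucasCoeff d k) (λ i → P m i * P m (i ℕ.+ d)))) ⟩
      Σ (suc m) (λ d → Σ (suc m) (λ i → term i d))
        ≈⟨ Σ-comm (suc m) (suc m) (λ d i → term i d) ⟩
      Σ (suc m) (λ i → Σ (suc m) (term i))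
        ≈⟨ Σ-truncate (suc (m ∸ k)) (suc m) _ (s≤s (ℕₚ.m∸n≤m m k)) (λ i m∸k<i → Σ-zero (suc m) (λ d _ → term-vanishes i d m∸k<i)) ⟩
      Σ (suc (m ∸ k)) (λ i → Σ (suc m) (term i))
        ≈⟨ Σ-cong (suc (m ∸ k)) row ⟩
      Σ (suc (m ∸ k)) (λ i → sumRange (i ℕ.+ k) m (h i)) ∎
      where
      term : ℕ → ℕ → Carrier
      term i d = (P m i * P m (i ℕ.+ d)) * lucasCoeff d k
      h : ℕ → ℕ → Carrier
      h i j = (P m i * P m j) * lucasCoeff (j ∸ i) k
      term-vanishes : ∀ i d → m ∸ k < i → term i d ≈ 0#
      term-vanishes i d m∸k<i with d ℕ.<? k
      ... | yes d<k = trans (*-congˡ (lucasCoeff-vanishes d<k)) (zeroʳ _)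
      ... | no d≮k = trans (*-congʳ (trans (*-congˡ (P-vanishes m<i+d)) (zeroʳ _))) (zeroˡ _)
        where
        m<i+d : m < i ℕ.+ d
        m<i+d = ℕₚ.≤-trans (ℕₚ.≤-reflexive (≡.cong suc (≡.sym (ℕₚ.m∸n+n≡m k≤m)))) (ℕₚ.+-mono-≤ m∸k<i (ℕₚ.≮⇒≥ d≮k))
      row : ∀ i → Σ (suc m) (term i) ≈ sumRange (i ℕ.+ k) m (h i)
      row i = begin
        Σ (suc m) (term i)
          ≡⟨ ≡.cong (λ n → Σ n (term i)) (≡.trans (≡.cong suc (≡.sym (ℕₚ.m+[n∸m]≡n k≤m))) (≡.sym (ℕₚ.+-suc k (m ∸ k)))) ⟩
        Σ (k ℕ.+ suc (m ∸ k)) (term i)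
          ≈⟨ Σ-++ k (suc (m ∸ k)) (term i) ⟩
        Σ k (term i) + Σ (suc (m ∸ k)) (λ t → term i (k ℕ.+ t))
          ≈⟨ +-congʳ (Σ-zero k (λ d d<k → trans (*-congˡ (lucasCoeff-vanishes d<k)) (zeroʳ _))) ⟩
        0# + Σ (suc (m ∸ k)) (λ t → term i (k ℕ.+ t))
          ≈⟨ +-identityˡ _ ⟩
        Σ (suc (m ∸ k)) (λ t → term i (k ℕ.+ t))
          ≈⟨ Σ-truncate n (suc (m ∸ k)) _ n≤1+m∸k (λ t n≤t → trans (*-congʳ (trans (*-congˡ (P-vanishes (m<i+[k+t] t n≤t))) (zeroʳ _))) (zeroˡ _)) ⟩
        Σ n (λ t → term i (k ℕ.+ t))
          ≈⟨ Σ-cong n (λ t → reflexive (≡.cong₂ (λ j d → (P m i * P m j) * lucasCoeff d k) (≡.sym (ℕₚ.+-assoc i k t)) (≡.sym (i+k+t∸i≡k+t t)))) ⟩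
        Σ n (λ t → h i (i ℕ.+ k ℕ.+ t))
          ≡⟨ sumFrom≡Σ (i ℕ.+ k) n (h i) ⟨
        sumRange (i ℕ.+ k) m (h i) ∎
        where
        n = suc m ∸ (i ℕ.+ k)
        n≤1+m∸k : n ≤ suc (m ∸ k)
        n≤1+m∸k = ℕₚ.≤-trans (ℕₚ.∸-monoʳ-≤ (suc m) (ℕₚ.m≤n+m k i)) (ℕₚ.≤-reflexive (ℕₚ.+-∸-assoc 1 k≤m))
        m<i+[k+t] : ∀ t → n ≤ t → m < i ℕ.+ (k ℕ.+ t)
        m<i+[k+t] t n≤t = ℕₚ.≤-trans (ℕₚ.m≤n+m∸n (suc m) (i ℕ.+ k))
                                     (ℕₚ.≤-trans (ℕₚ.+-monoʳ-≤ (i ℕ.+ k) n≤t) (ℕₚ.≤-reflexive (ℕₚ.+-assoc i k t)))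
        i+k+t∸i≡k+t : ∀ t → i ℕ.+ k ℕ.+ t ∸ i ≡ k ℕ.+ t
        i+k+t∸i≡k+t t = ≡.trans (≡.cong (_∸ i) (ℕₚ.+-assoc i k t)) (ℕₚ.m+n∸m≡n i (k ℕ.+ t))

  ⟦⟧²≈1 : ∀ s → ⟦ s ⟧ * ⟦ s ⟧ ≈ 1#
  ⟦⟧²≈1 upper = *-identityˡ 1#
  ⟦⟧²≈1 lower = trans (sym (-‿distribˡ-* 1# (- 1#))) (trans (-‿cong (*-identityˡ _)) (-‿involutive 1#))

  module GeometricCase (s : Sign) (r p : Carrier) where
    open GaussianBinomial p

    α : ℕ → Carrier
    α = geometric r

    open LucasExpansion ⟦ s ⟧ (⟦⟧²≈1 s) α public

    P*P*lucasCoeff≈coeff : ∀ K m i j → (∀ t → ¬ (1# - p ^ suc t ≈ 0#)) → ¬ (fromℕ (suc K) ≈ 0#) → i ℕ.+ suc K ≤ j →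
      (P m i * P m j) * lucasCoeff (j ∸ i) (suc K)
        ≈ ((coeff s (suc K) i j * qBinom p m i) * qBinom p m j) * (prod i α * prod j α)
    P*P*lucasCoeff≈coeff K m i j 1-p^t≉0 1+K≉0 i+k≤j = begin
      (P m i * P m j) * lucasCoeff (j ∸ i) (suc K)
        ≈⟨ *-cong (*-cong (Pᵢ≈ i) (Pᵢ≈ j)) (lucasCoeff-closed (s≤s z≤n) k≤j∸i 1+K≉0) ⟩
      ((qBinom p m i * prod i α) * (qBinom p m j * prod j α)) * coeff s (suc K) i j
        ≈⟨ solve 5 (λ a g b h c → ((a :* g) :* (b :* h)) :* c := ((c :* a) :* b) :* (g :* h)) refl (qBinom p m i) (prod i α) (qBinom p m j) (prod j α) (coeff s (suc K) i j) ⟩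
      ((coeff s (suc K) i j * qBinom p m i) * qBinom p m j) * (prod i α * prod j α) ∎
      where
      k≤j∸i : suc K ≤ j ∸ i
      k≤j∸i = ℕₚ.m+n≤o⇒m≤o∸n (suc K) (≡.subst (_≤ j) (ℕₚ.+-comm i (suc K)) i+k≤j)
      Pᵢ≈ : ∀ i → P m i ≈ qBinom p m i * prod i α
      Pᵢ≈ i = trans (linearProduct-geometric r m i) (*-congʳ (sym (qBinom≈gauss 1-p^t≉0 m i)))

    incrSum-closed : ∀ f K m → (∀ t → f (suc t) ≈ α t * β t ⁻¹) →
      (∀ t → ¬ (1# - ⟦ s ⟧ * α t ≈ 0#)) → (∀ t → ¬ (1# - p ^ suc t ≈ 0#)) → ¬ (fromℕ (suc K) ≈ 0#) → suc K ≤ m →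
      incrSum (suc K) 1 m f
        ≈ sq (qPoch (⟦ s ⟧ * r) p m) ⁻¹ *
          sumRange 0 (m ∸ suc K) (λ i → sumRange (i ℕ.+ suc K) m (λ j →
            ((coeff s (suc K) i j * qBinom p m i) * qBinom p m j) * (prod i α * prod j α)))
    incrSum-closed f K m f≈αβ⁻¹ 1-σα≉0 1-p^t≉0 1+K≉0 k≤m = begin
      incrSum k 1 m f
        ≈⟨ incrSum≈linearProduct f m k ⟩
      linearProduct (λ t → f (suc t)) one m k
        ≈⟨ x*y≈z⇒x≈z*y⁻¹ (prod≉0 m β β≉0) denominators-cleared ⟩
      linearProduct α β m k * prod m β ⁻¹
        ≈⟨ *-comm _ _ ⟩
      prod m β ⁻¹ * linearProduct α β m k
        ≈⟨ *-cong (⁻¹-cong prod-β) (trans (linearProduct-lucas m (suc m) k (ℕₚ.n<1+n m)) (Σ-by-pairs m k k≤m)) ⟩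
      sq (qPoch (⟦ s ⟧ * r) p m) ⁻¹ * Σ (suc (m ∸ k)) (λ i → sumRange (i ℕ.+ k) m (λ j → (P m i * P m j) * lucasCoeff (j ∸ i) k))
        ≈⟨ *-congˡ (Σ-cong (suc (m ∸ k)) (λ i → sumRange-cong (i ℕ.+ k) m (λ j i+k≤j _ → P*P*lucasCoeff≈coeff K m i j 1-p^t≉0 1+K≉0 i+k≤j))) ⟩
      sq (qPoch (⟦ s ⟧ * r) p m) ⁻¹ * Σ (suc (m ∸ k)) (λ i → sumRange (i ℕ.+ k) m (λ j →
            ((coeff s k i j * qBinom p m i) * qBinom p m j) * (prod i α * prod j α))) ∎
      where
      k = suc K
      β≉0 : ∀ t → ¬ (β t ≈ 0#)
      β≉0 t = x*y≉0 (1-σα≉0 t) (1-σα≉0 t)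
      denominators-cleared : linearProduct (λ t → f (suc t)) one m k * prod m β ≈ linearProduct α β m k
      denominators-cleared = trans (linearProduct-*-prod _ β m k)
        (linearProduct-cong (λ t → trans (*-congʳ (f≈αβ⁻¹ t)) (x*y⁻¹*y≈x (α t) (β≉0 t))) (λ _ → refl) m k)
      prod-β : prod m β ≈ sq (qPoch (⟦ s ⟧ * r) p m)
      prod-β = trans (prod-sq m _) (*-cong Π≈ Π≈)
        where Π≈ = prod-cong m (λ t → +-congˡ (-‿cong (sym (*-assoc _ _ _))))

  1-x≉0 : ∀ {x} → ¬ (x ≈ 1#) → ¬ (1# - x ≈ 0#)
  1-x≉0 x≉1 1-x≈0 = x≉1 (1-x≈0⇒x≈1 1-x≈0)

  1-⟦s⟧x≉0 : ∀ s {x} → ¬ (x ≈ 1#) → ¬ (x ≈ - 1#) → ¬ (1# - ⟦ s ⟧ * x ≈ 0#)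
  1-⟦s⟧x≉0 upper x≉1 _ 1-x≈0 = x≉1 (trans (sym (*-identityˡ _)) (1-x≈0⇒x≈1 1-x≈0))
  1-⟦s⟧x≉0 lower _ x≉-1 1+x≈0 = x≉-1 (begin
    _            ≈⟨ -‿involutive _ ⟨
    - - _        ≈⟨ -‿cong (-1*x≈-x _) ⟨
    - (- 1# * _) ≈⟨ -‿cong (1-x≈0⇒x≈1 1+x≈0) ⟩
    - 1#         ∎)

  prod-q^[1+t] : ∀ q i → prod i (λ t → q * q ^ t) ≈ q ^ (i ℕ.* suc i ℕ./ 2)
  prod-q^[1+t] q zero = refl
  prod-q^[1+t] q (suc i) = begin
    prod i (λ t → q * q ^ t) * q ^ suc i ≈⟨ *-congʳ (prod-q^[1+t] q i) ⟩
    q ^ (i ℕ.* suc i ℕ./ 2) * q ^ suc i  ≈⟨ ^-homo-* q (i ℕ.* suc i ℕ./ 2) (suc i) ⟨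
    q ^ (i ℕ.* suc i ℕ./ 2 ℕ.+ suc i)    ≈⟨ ^-congʳ q (triangular-suc i) ⟨
    q ^ (suc i ℕ.* suc (suc i) ℕ./ 2)    ∎

  prod-q*[q*q]^t : ∀ q i → prod i (λ t → q * (q * q) ^ t) ≈ q ^ (i ℕ.* i)
  prod-q*[q*q]^t q zero = refl
  prod-q*[q*q]^t q (suc i) = begin
    prod i (λ t → q * (q * q) ^ t) * (q * (q * q) ^ i) ≈⟨ *-cong (prod-q*[q*q]^t q i) (*-congˡ ([x*x]^n≈x^[n+n] q i)) ⟩
    q ^ (i ℕ.* i) * q ^ suc (i ℕ.+ i)                  ≈⟨ ^-homo-* q (i ℕ.* i) (suc (i ℕ.+ i)) ⟨
    q ^ (i ℕ.* i ℕ.+ suc (i ℕ.+ i))                    ≈⟨ ^-congʳ q (square-suc i) ⟩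
    q ^ (suc i ℕ.* suc i)                              ∎

  A≈rhsA : ∀ q → (∀ n → ¬ (q ^ suc n ≈ 1#) × ¬ (q ^ suc n ≈ - 1#)) →
           ∀ s K m → ¬ (fromℕ (suc K) ≈ 0#) → suc K ≤ m → A s (suc K) m q ≈ rhsA s (suc K) m q
  A≈rhsA q q^n≉±1 s K m 1+K≉0 1+K≤m = begin
    A s (suc K) m q
      ≈⟨ incrSum-closed _ K m (λ _ → refl) 1-σα≉0 1-p^t≉0 1+K≉0 1+K≤m ⟩
    _ ≈⟨ *-congˡ (Σ-cong (suc (m ∸ suc K)) (λ i → sumRange-cong (i ℕ.+ suc K) m (λ j _ _ → *-congˡ (exponents i j)))) ⟩
    rhsA s (suc K) m q ∎
    where
    open GeometricCase s q q
    1-σα≉0 : ∀ t → ¬ (1# - ⟦ s ⟧ * α t ≈ 0#)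
    1-σα≉0 t = 1-⟦s⟧x≉0 s (proj₁ (q^n≉±1 t)) (proj₂ (q^n≉±1 t))
    1-p^t≉0 : ∀ t → ¬ (1# - q ^ suc t ≈ 0#)
    1-p^t≉0 t = 1-x≉0 (proj₁ (q^n≉±1 t))
    exponents : ∀ i j → prod i α * prod j α ≈ q ^ (i ℕ.* suc i ℕ./ 2 ℕ.+ j ℕ.* suc j ℕ./ 2)
    exponents i j = trans (*-cong (prod-q^[1+t] q i) (prod-q^[1+t] q j)) (sym (^-homo-* q (i ℕ.* suc i ℕ./ 2) (j ℕ.* suc j ℕ./ 2)))

  Cser≈rhsC : ∀ q → (∀ n → ¬ (q ^ suc n ≈ 1#) × ¬ (q ^ suc n ≈ - 1#)) →
              ∀ s K m → ¬ (fromℕ (suc K) ≈ 0#) → suc K ≤ m → Cser s (suc K) m q ≈ rhsC s (suc K) m q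
  Cser≈rhsC q q^n≉±1 s K m 1+K≉0 1+K≤m = begin
    Cser s (suc K) m q
      ≈⟨ incrSum-closed _ K m f≈αβ⁻¹ 1-σα≉0 1-p^t≉0 1+K≉0 1+K≤m ⟩
    _ ≈⟨ *-congˡ (Σ-cong (suc (m ∸ suc K)) (λ i → sumRange-cong (i ℕ.+ suc K) m (λ j _ _ → *-congˡ (exponents i j)))) ⟩
    rhsC s (suc K) m q ∎
    where
    open GeometricCase s q (q * q)
    α≈q^[1+2t] : ∀ t → α t ≈ q ^ suc (t ℕ.+ t)
    α≈q^[1+2t] t = *-congˡ ([x*x]^n≈x^[n+n] q t)
    q^[2[1+t]∸1]≈α : ∀ t → q ^ (2 ℕ.* suc t ∸ 1) ≈ α t
    q^[2[1+t]∸1]≈α t = trans (^-congʳ q (≡.trans (≡.cong (t ℕ.+_) (ℕₚ.+-identityʳ (suc t))) (ℕₚ.+-suc t t))) (sym (α≈q^[1+2t] t))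
    f≈αβ⁻¹ : ∀ t → q ^ (2 ℕ.* suc t ∸ 1) * sq (1# - ⟦ s ⟧ * q ^ (2 ℕ.* suc t ∸ 1)) ⁻¹ ≈ α t * β t ⁻¹
    f≈αβ⁻¹ t = *-cong (q^[2[1+t]∸1]≈α t) (⁻¹-cong (*-cong 1-σx≈ 1-σx≈))
      where 1-σx≈ = +-congˡ (-‿cong (*-congˡ (q^[2[1+t]∸1]≈α t)))
    1-σα≉0 : ∀ t → ¬ (1# - ⟦ s ⟧ * α t ≈ 0#)
    1-σα≉0 t = 1-⟦s⟧x≉0 s (λ α≈1 → proj₁ (q^n≉±1 (t ℕ.+ t)) (trans (sym (α≈q^[1+2t] t)) α≈1))
                          (λ α≈-1 → proj₂ (q^n≉±1 (t ℕ.+ t)) (trans (sym (α≈q^[1+2t] t)) α≈-1))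
    1-p^t≉0 : ∀ t → ¬ (1# - (q * q) ^ suc t ≈ 0#)
    1-p^t≉0 t = 1-x≉0 (λ p^t≈1 → proj₁ (q^n≉±1 (t ℕ.+ suc t)) (trans (sym ([x*x]^n≈x^[n+n] q (suc t))) p^t≈1))
    exponents : ∀ i j → prod i α * prod j α ≈ q ^ (i ℕ.* i ℕ.+ j ℕ.* j)
    exponents i j = trans (*-cong (prod-q*[q*q]^t q i) (prod-q*[q*q]^t q j)) (sym (^-homo-* q (i ℕ.* i) (j ℕ.* j)))

theorem2p1 : {c ℓ : Level} (F : Field c ℓ) → FieldDefs.CharZero F →
             (q : Field.Carrier F) →
             (∀ (n : ℕ) → ¬ (Field._≈_ F (FieldDefs._^_ F q (suc n)) (Field.1# F))
                         × ¬ (Field._≈_ F (FieldDefs._^_ F q (suc n)) (Field.-_ F (Field.1# F)))) →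
             (k m : ℕ) → 1 ≤ k → k ≤ m → (s : Sign) →
             Field._≈_ F (FieldDefs.A F s k m q) (FieldDefs.rhsA F s k m q)
             × Field._≈_ F (FieldDefs.Cser F s k m q) (FieldDefs.rhsC F s k m q)
theorem2p1 F charZero q q^n≉±1 (suc K) m _ 1+K≤m s =
  A≈rhsA q q^n≉±1 s K m (charZero K) 1+K≤m , Cser≈rhsC q q^n≉±1 s K m (charZero K) 1+K≤m
  where open Expansion F
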